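{- Let $n\ge r\ge 0$. The map $\mathrm{spl}$, sending $T\in\mathrm{RAT}(n,r)$ to the collection $\{T[L]:L\in[n]/\simeq\}$, is a bijection between $\mathrm{RAT}(n,r)$ and the set of collections of packed labeled RAT whose label sets form a set partition of $[n]$ and exactly $r$ of which are of diagonal type. Moreover, for $T\in\mathrm{RAT}(n,r)$, the number of packed RAT of horizontal (resp. vertical) type in $\mathrm{spl}(T)$ equals the number of free rows (resp. free columns) of $T$.
   Context: Rhombic diagrams. For a word $w=w_1\cdots w_m\in\{0,1,2\}^m$, the rhombic diagram $\Gamma_w$ is the region bounded by two lattice paths from a common starting point: the southeast border, obtained by reading $w$ left to right with a unit step south for each $2$, southwest (vector $(-1,-1)$) for each $1$, west for each $0$; and the northwest border, consisting of (number of $0$'s) steps west, then (number of $1$'s) steps southwest, then (number of $2$'s) steps south. It is tiled by unit squares, tall rhombi (two vertical and two diagonal sides) and short rhombi (two horizontal and two diagonal sides) via the maximal tiling: if no $i$ has $w_i>w_{i+1}$ there is nothing to tile; otherwise take the smallest such $i$, tile the region of the word obtained by swapping $w_i,w_{i+1}$, and fill the remaining tile by a tall rhombus, square or short rhombus according as $(w_i,w_{i+1})=(2,1),(2,0),(1,0)$. When the southeast border edges are labeled by $\ell_1<\cdots<\ell_m$ from northeast to southwest, each edge starts a strip (maximal sequence of tiles connected through parallel edges, possibly empty) carrying its label; strips from vertical edges are rows, from horizontal edges columns, from diagonal edges diagonal strips. For labels $i<j$, the cell $(i,j)$ is the tile common to strips $i$ and $j$, if it exists. A RAT is a filling of some tiles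 with up-arrows (only in tiles of a column) and left-arrows (only in tiles of a row) such that no arrow lies in a cell pointed to by another arrow, where a left-arrow points to all other cells of its row to its west and an up-arrow to all other cells of its column to its north. A RAT of size $(m,r')$ has $m$ border steps, $r'$ of them diagonal; $\mathrm{RAT}(n,r)$ is the set of RAT of size $(n,r)$ labeled by $[n]$. A free row (column) is a row (column) containing no left-arrow (up-arrow). Splitting. For $T\in\mathrm{RAT}(n,r)$, let $\simeq$ be the smallest equivalence relation on $[n]$ with $i\simeq j$ whenever cell $(i,j)$ contains an arrow. For a set $L\subseteq[n]$, $T[L]$ is the RAT labeled by $L$ obtained by restricting $T$ to its border edges with labels in $L$ (same directions and order) and the cells $(i,j)$ with $i,j\in L$, with their contents. A labeled RAT is a RAT whose southeast border is labeled by the increasing elements of some finite set. A RAT of size $(m,r')$ is packed if it contains exactly $m-1$ arrows (which can only occur for $r'\in\{0,1\}$); a packed RAT of size $(m,0)$ is of horizontal type if its top row contains no left-arrow, and of vertical type if its leftmost column contains no up-arrow; a packed RAT of size $(m,1)$ is of diagonal type. -}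

module Defs where

open import Data.Bool using (Bool; true; false; _∧_; _∨_; not; if_then_else_)
open import Data.Nat using (ℕ; zero; suc; _+_; _*_; _≡ᵇ_)
open import Data.Fin using (Fin)
open import Data.Fin.Properties using (_≟_)
open import Data.Fin.Subset using (Subset; _∈_)
open import Data.Maybe using (Maybe; just; nothing)
open import Data.List using (List; []; _∷_; length; mapMaybe; allFin; map; reverse)
open import Data.Nat.ListAction using (sum)
open import Data.Bool.ListAction using (any)
import Data.List.Membership.Propositional as LM
open import Data.Vec using (Vec; lookup; tabulate)
open import Data.Product using (Σ; _×_; _,_; proj₁; proj₂; ∃)
open import Data.Sum using (_⊎_)
open import Relation.Binary.PropositionalEquality using (_≡_; _≢_)
open import Relation.Nullary.Decidable using (⌊_⌋)
open import Relation.Binary.Construct.Closure.Equivalence using (EqClosure)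

data Letter : Set where
  l0 l1 l2 : Letter

_>L_ : Letter → Letter → Bool
l2 >L l1 = true
l2 >L l0 = true
l1 >L l0 = true
_  >L _  = false

isL0 isL1 isL2 : Letter → Bool
isL0 l0 = true
isL0 _  = false
isL1 l1 = true
isL1 _  = false
isL2 l2 = true
isL2 _  = false

data Content : Set where
  empty leftArrow upArrow : Content

isArrow isLeft isUp : Content → Bool
isArrow empty = false
isArrow _     = true
isLeft leftArrow = true
isLeft _         = false
isUp upArrow = true
isUp _       = false

countB : {A : Set} → (A → Bool) → List A → ℕ
countB p []       = 0
countB p (x ∷ xs) = if p x then suc (countB p xs) else countB p xs

-- Maximal tiling of a rhombic diagram, computed on the labeled word
-- (list of (label, letter) in border order, i.e. increasing labels).
-- One step: at the smallest descent w_i > w_{i+1}, swap; the tile filled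
-- there is common to the strips of the two labels (smaller label first).

module _ {A : Set} where
  consStep : A × Letter → Maybe (List (A × Letter) × (A × A)) → Maybe (List (A × Letter) × (A × A))
  consStep x nothing         = nothing
  consStep x (just (l , t))  = just ((x ∷ l) , t)

  step : List (A × Letter) → Maybe (List (A × Letter) × (A × A))
  stepFrom : A × Letter → List (A × Letter) → Maybe (List (A × Letter) × (A × A))
  step []       = nothing
  step (x ∷ xs) = stepFrom x xs
  stepFrom x [] = nothing
  stepFrom (a , p) ((b , q) ∷ rest) =
    if p >L q then just (((b , q) ∷ (a , p) ∷ rest) , (a , b))
    else consStep (a , p) (stepFrom (b , q) rest)

  -- run the recursion with fuel; fuel m*m exceeds the number of
  -- inversions, so the recursion always reaches a sorted word.
  runTiling : ℕ → List (A × Letter) → List (A × A)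
  runTiling zero    _ = []
  runTiling (suc k) w with step w
  ... | nothing       = []
  ... | just (w' , t) = t ∷ runTiling k w'

  -- tiles in order of their placement: the k-th tile involving a label
  -- is the k-th tile of its strip counted from the southeast border.
  maximalTiling : List (A × Letter) → List (A × A)
  maximalTiling w = runTiling (length w * length w) w

  data Precedes (x y : A × A) : List (A × A) → Set where
    here  : ∀ {xs} → y LM.∈ xs → Precedes x y (x ∷ xs)
    there : ∀ {z xs} → Precedes x y xs → Precedes x y (z ∷ xs)

-- A (possibly partially) labeled diagram with filling, labels ⊆ Fin n.
-- word i = nothing  means label i is not used.

record LRAT (n : ℕ) : Set where
  constructor mkLRAT
  field
    word : Vec (Maybe Letter) n
    fill : Vec (Vec Content n) n
open LRAT public

module _ {n : ℕ} (T : LRAT n) where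
  letterOf : Fin n → Maybe Letter
  letterOf i = lookup (word T) i

  fillAt : Fin n × Fin n → Content
  fillAt (i , j) = lookup (lookup (fill T) i) j

  -- southeast border, read from northeast to southwest
  border : List (Fin n × Letter)
  border = mapMaybe (λ i → Data.Maybe.map (λ x → (i , x)) (letterOf i)) (allFin n)

  tiles : List (Fin n × Fin n)
  tiles = maximalTiling border

  IsCell : Fin n × Fin n → Set
  IsCell c = c LM.∈ tiles

  InStrip : Fin n → Fin n × Fin n → Set
  InStrip k (i , j) = k ≡ i ⊎ k ≡ j

  InRow InCol : Fin n → Fin n × Fin n → Set
  InRow k c = IsCell c × InStrip k c × letterOf k ≡ just l2
  InCol k c = IsCell c × InStrip k c × letterOf k ≡ just l0

  -- the arrow in c points to c' (c' further west in the same row,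
  -- resp. further north in the same column)
  Points : Fin n × Fin n → Fin n × Fin n → Set
  Points c c' =
      (fillAt c ≡ leftArrow × ∃ λ k → InRow k c × InRow k c' × Precedes c c' tiles)
    ⊎ (fillAt c ≡ upArrow   × ∃ λ k → InCol k c × InCol k c' × Precedes c c' tiles)

  IsRATFilling : Set
  IsRATFilling =
      (∀ c → fillAt c ≢ empty → IsCell c)
    × (∀ c → fillAt c ≡ leftArrow → ∃ λ k → InRow k c)
    × (∀ c → fillAt c ≡ upArrow → ∃ λ k → InCol k c)
    × (∀ c c' → Points c c' → fillAt c' ≡ empty)

  size diagonals arrows : ℕ
  size      = length border
  diagonals = countB (λ x → isL1 (proj₂ x)) border
  arrows    = sum (map (λ i → countB (λ j → isArrow (fillAt (i , j))) (allFin n)) (allFin n))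

  hasLabel : Fin n → Bool
  hasLabel i with letterOf i
  ... | just _  = true
  ... | nothing = false

  letterIs : (Letter → Bool) → Fin n → Bool
  letterIs p i with letterOf i
  ... | just x  = p x
  ... | nothing = false

  inTile : Fin n → Fin n × Fin n → Bool
  inTile k (i , j) = ⌊ k ≟ i ⌋ ∨ ⌊ k ≟ j ⌋

  leftInStrip upInStrip : Fin n → Bool
  leftInStrip k = any (λ c → inTile k c ∧ isLeft (fillAt c)) tiles
  upInStrip   k = any (λ c → inTile k c ∧ isUp (fillAt c)) tiles

  freeRows freeCols : ℕ
  freeRows = countB (λ k → letterIs isL2 k ∧ not (leftInStrip k)) (allFin n)
  freeCols = countB (λ k → letterIs isL0 k ∧ not (upInStrip k)) (allFin n)

  firstWith : (Letter → Bool) → List (Fin n × Letter) → Maybe (Fin n)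
  firstWith p []            = nothing
  firstWith p ((i , x) ∷ w) = if p x then just i else firstWith p w

  -- top row: row of the northeast-most vertical border edge;
  -- leftmost column: column of the southwest-most horizontal border edge
  topRow leftmostCol : Maybe (Fin n)
  topRow      = firstWith isL2 border
  leftmostCol = firstWith isL0 (reverse border)

  packedB : Bool
  packedB = (arrows + 1) ≡ᵇ size

  Packed : Set
  Packed = arrows + 1 ≡ size

  horizontalB verticalB diagonalB : Bool
  horizontalB with topRow
  ... | just k  = packedB ∧ (diagonals ≡ᵇ 0) ∧ not (leftInStrip k)
  ... | nothing = false
  verticalB with leftmostCol
  ... | just k  = packedB ∧ (diagonals ≡ᵇ 0) ∧ not (upInStrip k)
  ... | nothing = false
  diagonalB = packedB ∧ (diagonals ≡ᵇ 1)

  InRAT : ℕ → Set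
  InRAT r = (∀ i → letterOf i ≢ nothing) × diagonals ≡ r × IsRATFilling

  ArrowRel : Fin n → Fin n → Set
  ArrowRel i j = fillAt (i , j) ≢ empty

  _≃_ : Fin n → Fin n → Set
  _≃_ = EqClosure ArrowRel

  IsClass : Subset n → Set
  IsClass L = ∃ λ i → ∀ j → (j ∈ L → i ≃ j) × (i ≃ j → j ∈ L)

  restrict : Subset n → LRAT n
  restrict L = mkLRAT
    (tabulate λ i → if lookup L i then letterOf i else nothing)
    (tabulate λ i → tabulate λ j →
        if lookup L i ∧ lookup L j then fillAt (i , j) else empty)

  InSpl : LRAT n → Set
  InSpl X = Σ (Subset n) λ L → IsClass L × X ≡ restrict L

ValidColl : (n r : ℕ) → List (LRAT n) → Set
ValidColl n r C =
    (∀ X → X LM.∈ C → IsRATFilling X × Packed X)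
  × (∀ (k : Fin n) → countB (λ X → hasLabel X k) C ≡ 1)
  × (∀ X → X LM.∈ C → ∃ λ k → hasLabel X k ≡ true)
  × countB diagonalB C ≡ r

Represents : {n : ℕ} → List (LRAT n) → LRAT n → Set
Represents C T = ∀ X → (X LM.∈ C → InSpl T X) × (InSpl T X → X LM.∈ C)

-- The maximal tiling is a bubble sort of the word: it lays one tile (i , j) for each inversion,
-- i < j with letter i > letter j, in the order of j. Hence whether two labels span a tile, and
-- in which order two tiles are laid, depend only on the letters at their labels, so restricting
-- a RAT to a set of labels, or gluing RAT with disjoint label sets, again gives RAT fillings.
--
-- Each arrow is owned by one of its two labels: a left-arrow by its row, an up-arrow by its
-- column; a label owns at most one arrow, since an arrow points at all later cells of its strip.
-- Joining every label to the other label of the arrow it owns gives a forest: its links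
-- alternate between rows and columns and the rows along a chain have decreasing labels. Its
-- trees are the classes of ≃, and its roots are the free rows, the free columns and the
-- diagonal labels. So a class L has |L| - 1 arrows, T[L] is packed, and the kind of its unique
-- root (for a packed RAT necessarily its top row, its leftmost column, or its diagonal label)
-- is the type of T[L]. Summing over the classes gives the counts of types; gluing the pieces
-- of a valid collection inverts spl.

module Submission where

open import Defs
open import Data.Bool using (Bool; true; false; _∧_; not; if_then_else_; T?)
open import Data.Bool.ListAction using (any)
open import Data.Bool.Properties using (T-≡; ∧-zeroʳ; ⇔→≡)
open import Data.Empty using (⊥-elim)
open import Data.Fin using (Fin; zero; suc; toℕ)
import Data.Fin.Properties as Fin
open import Data.List using (List; []; _∷_; _++_; [_]; map; reverse; length; allFin; mapMaybe; tabulate; filterᵇ)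
open import Data.List.Properties using (++-assoc; reverse-++; unfold-reverse; length-map; length-++; ++-identityʳ; map-cong-local)
open import Data.List.Membership.Propositional using (_∈_; find; lose)
open import Data.List.Membership.Propositional.Properties using (∈-++⁺ˡ; ∈-++⁺ʳ; ∈-++⁻; ∈-map⁺; ∈-map⁻; ∈-allFin; ∈-filter⁺; ∈-filter⁻)
open import Data.List.Relation.Unary.All as All using (All; []; _∷_)
import Data.List.Relation.Unary.All.Properties as All
open import Data.List.Relation.Unary.AllPairs as AllPairs using (AllPairs; []; _∷_)
import Data.List.Relation.Unary.AllPairs.Properties as AllPairs
open import Data.List.Relation.Unary.Any using (here; there)
import Data.List.Relation.Unary.Any.Properties as Any
open import Data.Maybe using (Maybe; just; nothing; is-just; maybe′; _<∣>_)
import Data.Maybe as Maybe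
open import Data.Nat using (ℕ; zero; suc; _+_; _*_; _∸_; _≤_; _<_; z≤n; s≤s; _≡ᵇ_)
open import Data.Nat.ListAction using (sum)
open import Data.Nat.Properties
open import Algebra.Properties.CommutativeMonoid.Sum +-0-commutativeMonoid
  using (∑-distrib-+; ∑-comm; sum-cong-≗; sum-replicate-zero) renaming (sum to ∑)
open import Data.Product using (Σ; ∃; _×_; _,_; proj₁; proj₂; map₁; map₂)
open import Data.Sum using (_⊎_; inj₁; inj₂; [_,_]′)
open import Function using (_∘_; id; flip; Equivalence; mk⇔)
open import Relation.Binary.Definitions using (Asymmetric; tri<; tri≈; tri>)
open import Relation.Nullary using (yes; no)
open import Relation.Nullary.Decidable using (⌊_⌋)
open import Relation.Binary.PropositionalEquality hiding ([_])
open import Relation.Binary.Construct.Closure.ReflexiveTransitive using (ε; _◅_; _◅◅_)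
open import Relation.Binary.Construct.Closure.Symmetric using (SymClosure; fwd; bwd)
import Relation.Binary.Construct.Closure.Equivalence as EqClosure
open import Data.Fin.Subset using (Subset)
open import Data.Vec using (Vec; lookup)
import Data.Vec as Vec
open import Data.Vec.Properties using (lookup∘tabulate; tabulate∘lookup; tabulate-cong; []=⇒lookup; lookup⇒[]=)
import Relation.Binary.Construct.On as On

module _ {A : Set} where

  AllPairs-++⁻ : ∀ {R : A → A → Set} xs {ys} → AllPairs R (xs ++ ys) →
                 AllPairs R xs × AllPairs R ys × All (λ x → All (R x) ys) xs
  AllPairs-++⁻ []       rs       = [] , rs , []
  AllPairs-++⁻ (x ∷ xs) (r ∷ rs) with AllPairs-++⁻ xs rs
  ... | rxs , rys , cross = All.++⁻ˡ xs r ∷ rxs , rys , All.++⁻ʳ xs r ∷ cross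

  All-reverse⁺ : ∀ {P : A → Set} {xs} → All P xs → All P (reverse xs)
  All-reverse⁺ ps = All.tabulate λ x∈ → All.lookup ps (Any.reverse⁻ x∈)

  reverse-++-++ : ∀ (us vs ws : List A) → reverse (us ++ vs) ++ ws ≡ reverse vs ++ reverse us ++ ws
  reverse-++-++ us vs ws rewrite reverse-++ us vs = ++-assoc (reverse vs) (reverse us) ws

  reverse-∷-++ : ∀ (z : A) (zs ws : List A) → reverse zs ++ z ∷ ws ≡ reverse (z ∷ zs) ++ ws
  reverse-∷-++ z zs ws rewrite unfold-reverse z zs = sym (++-assoc (reverse zs) [ z ] ws)

  AllPairs-reverse⁺ : ∀ {R : A → A → Set} {xs} → AllPairs R xs → AllPairs (flip R) (reverse xs)
  AllPairs-reverse⁺ {xs = []}             []       = []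
  AllPairs-reverse⁺ {R = R} {xs = x ∷ xs} (r ∷ rs) =
    subst (AllPairs (flip R)) (sym (unfold-reverse x xs))
      (AllPairs.++⁺ (AllPairs-reverse⁺ rs) ([] ∷ []) (All.map (_∷ []) (All-reverse⁺ r)))

module _ {A : Set} where

  Precedes⇒∈ : ∀ {x y : A × A} {l} → Precedes x y l → x ∈ l × y ∈ l
  Precedes⇒∈ (here y∈)  = here refl , there y∈
  Precedes⇒∈ (there xy) = map₁ there (map₂ there (Precedes⇒∈ xy))

  Precedes-connex : ∀ {x y : A × A} {l} → x ∈ l → y ∈ l → x ≢ y → Precedes x y l ⊎ Precedes y x l
  Precedes-connex (here refl) (here refl) x≢y = ⊥-elim (x≢y refl)
  Precedes-connex (here refl) (there y∈)  _   = inj₁ (here y∈)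
  Precedes-connex (there x∈)  (here refl) _   = inj₂ (here x∈)
  Precedes-connex (there x∈)  (there y∈)  x≢y =
    [ inj₁ ∘ there , inj₂ ∘ there ]′ (Precedes-connex x∈ y∈ x≢y)

module _ {A : Set} {R : A × A → A × A → Set} where

  precedes⇒related : ∀ {x y : A × A} {l} → AllPairs R l → Precedes x y l → R x y
  precedes⇒related (r ∷ _)  (here y∈)  = All.lookup r y∈
  precedes⇒related (_ ∷ rs) (there xy) = precedes⇒related rs xy

  related⇒precedes : Asymmetric R → ∀ {x y : A × A} {l} → AllPairs R l → x ∈ l → y ∈ l → R x y → Precedes x y l
  related⇒precedes asym rs x∈ y∈ r =
    [ id , (λ yx → ⊥-elim (asym r (precedes⇒related rs yx))) ]′ (Precedes-connex x∈ y∈ λ { refl → asym r r })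

𝟙 : Bool → ℕ
𝟙 true  = 1
𝟙 false = 0

∑-zero : ∀ {m} {f : Fin m → ℕ} → (∀ i → f i ≡ 0) → ∑ f ≡ 0
∑-zero {m} f≡0 = trans (sum-cong-≗ f≡0) (sum-replicate-zero m)

∑-𝟙-positive : ∀ {m} (p : Fin m → Bool) {i} → p i ≡ true → 1 ≤ ∑ (𝟙 ∘ p)
∑-𝟙-positive p {zero}  pi rewrite pi = s≤s z≤n
∑-𝟙-positive p {suc i} pi = ≤-trans (∑-𝟙-positive (p ∘ suc) pi) (m≤n+m _ (𝟙 (p zero)))

∑-𝟙≡1⇒unique : ∀ {m} (p : Fin m → Bool) {i j} → ∑ (𝟙 ∘ p) ≡ 1 → p i ≡ true → p j ≡ true → i ≡ j
∑-𝟙≡1⇒unique p {zero}  {zero}  _ _  _  = refl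
∑-𝟙≡1⇒unique p {zero}  {suc j} s pi pj = ⊥-elim (n≮0 (subst (1 ≤_) rest≡0 (∑-𝟙-positive (p ∘ suc) pj)))
  where
  rest≡0 : ∑ (𝟙 ∘ p ∘ suc) ≡ 0
  rest≡0 = suc-injective (subst (λ b → 𝟙 b + ∑ (𝟙 ∘ p ∘ suc) ≡ 1) pi s)
∑-𝟙≡1⇒unique p {suc i} {zero}  s pi pj = sym (∑-𝟙≡1⇒unique p s pj pi)
∑-𝟙≡1⇒unique p {suc i} {suc j} s pi pj with p zero in p0
... | false = cong suc (∑-𝟙≡1⇒unique (p ∘ suc) s pi pj)
... | true  with () ← ∑-𝟙≡1⇒unique p {zero} {suc i} (subst (λ b → 𝟙 b + ∑ (𝟙 ∘ p ∘ suc) ≡ 1) (sym p0) s) p0 pi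

search : ∀ {m} → (Fin m → Bool) → Maybe (Fin m)
search {zero}  p = nothing
search {suc m} p = if p zero then just zero else Maybe.map suc (search (p ∘ suc))

search-just : ∀ {m} (p : Fin m → Bool) {j} → search p ≡ just j → p j ≡ true
search-just {suc m} p s with p zero in p0 | search (p ∘ suc) in s′
search-just {suc m} p refl | true  | _      = p0
search-just {suc m} p refl | false | just j = search-just (p ∘ suc) s′

search-nothing : ∀ {m} (p : Fin m → Bool) → search p ≡ nothing → ∀ j → p j ≡ false
search-nothing {suc m} p s j with p zero in p0 | search (p ∘ suc) in s′
search-nothing {suc m} p () j       | true  | _
search-nothing {suc m} p s  zero    | false | nothing = p0
search-nothing {suc m} p s  (suc j) | false | nothing = search-nothing (p ∘ suc) s′ j

∑-𝟙-search : ∀ {m} (p : Fin m → Bool) → (∀ i j → p i ≡ true → p j ≡ true → i ≡ j) →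
             ∑ (𝟙 ∘ p) ≡ 𝟙 (is-just (search p))
∑-𝟙-search {zero}  p _    = refl
∑-𝟙-search {suc m} p uniq with p zero in p0
... | true  = cong suc (∑-zero λ i → none i)
  where
  none : ∀ i → 𝟙 (p (suc i)) ≡ 0
  none i with p (suc i) in pi
  ... | false = refl
  ... | true  with () ← uniq _ _ p0 pi
... | false with search (p ∘ suc) | ∑-𝟙-search (p ∘ suc) (λ i j pi pj → Fin.suc-injective (uniq _ _ pi pj))
... | just _  | s = s
... | nothing | s = s

∑-𝟙-single : ∀ {m} (p : Fin m → Bool) {i} → (∀ j → p j ≡ true → j ≡ i) → p i ≡ true → ∑ (𝟙 ∘ p) ≡ 1
∑-𝟙-single p {i} only pi with search p in s | ∑-𝟙-search p (λ j k pj pk → trans (only j pj) (sym (only k pk)))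
... | just _  | eq = eq
... | nothing | _  with () ← trans (sym pi) (search-nothing p s i)

countB-tabulate : ∀ {A : Set} {m} (p : A → Bool) (f : Fin m → A) → countB p (tabulate f) ≡ ∑ (𝟙 ∘ p ∘ f)
countB-tabulate {m = zero}  p f = refl
countB-tabulate {m = suc m} p f with p (f zero)
... | true  = cong suc (countB-tabulate p (f ∘ suc))
... | false = countB-tabulate p (f ∘ suc)

countB-allFin : ∀ {m} (p : Fin m → Bool) → countB p (allFin m) ≡ ∑ (𝟙 ∘ p)
countB-allFin p = countB-tabulate p id

sum-map-tabulate : ∀ {A : Set} {m} (g : A → ℕ) (f : Fin m → A) → sum (map g (tabulate f)) ≡ ∑ (g ∘ f)
sum-map-tabulate {m = zero}  g f = refl
sum-map-tabulate {m = suc m} g f = cong (g (f zero) +_) (sum-map-tabulate g (f ∘ suc))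

∧≡true⁻ : ∀ {a b} → a ∧ b ≡ true → a ≡ true × b ≡ true
∧≡true⁻ {true} {true} _ = refl , refl

any≡true⁻ : ∀ {A : Set} (p : A → Bool) xs → any p xs ≡ true → ∃ λ x → x ∈ xs × p x ≡ true
any≡true⁻ p xs eq with x , x∈ , px ← find (Any.any⁻ p xs (Equivalence.from T-≡ eq)) = x , x∈ , Equivalence.to T-≡ px

any≡true⁺ : ∀ {A : Set} (p : A → Bool) {xs x} → x ∈ xs → p x ≡ true → any p xs ≡ true
any≡true⁺ p x∈ px = Equivalence.to T-≡ (Any.any⁺ p (lose x∈ (Equivalence.from T-≡ px)))

one-of-three : ∀ a b c → a + b + c ≡ 1 → a ≡ 0 ⊎ (a ≡ 1 × b ≡ 0 × c ≡ 0)
one-of-three zero          b    c    _ = inj₁ refl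
one-of-three (suc zero)    zero zero _ = inj₂ (refl , refl , refl)
one-of-three (suc zero)    zero (suc c) ()
one-of-three (suc zero)    (suc b) c ()
one-of-three (suc (suc a)) b    c    ()

𝟙-≡ᵇ1 : ∀ {d} → d ≤ 1 → 𝟙 (d ≡ᵇ 1) ≡ d
𝟙-≡ᵇ1 z≤n       = refl
𝟙-≡ᵇ1 (s≤s z≤n) = refl

module _ {A : Set} where

  countB-map-filterᵇ : ∀ {B : Set} (p : A → Bool) (f : A → B) (q : B → Bool) xs →
                       countB q (map f (filterᵇ p xs)) ≡ countB (λ x → p x ∧ q (f x)) xs
  countB-map-filterᵇ p f q []       = refl
  countB-map-filterᵇ p f q (x ∷ xs) with p x
  ... | false = countB-map-filterᵇ p f q xs
  ... | true with q (f x)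
  ...   | true  = cong suc (countB-map-filterᵇ p f q xs)
  ...   | false = countB-map-filterᵇ p f q xs

  countB≡sum-map-𝟙 : ∀ (p : A → Bool) xs → countB p xs ≡ sum (map (𝟙 ∘ p) xs)
  countB≡sum-map-𝟙 p []       = refl
  countB≡sum-map-𝟙 p (x ∷ xs) with p x
  ... | true  = cong suc (countB≡sum-map-𝟙 p xs)
  ... | false = countB≡sum-map-𝟙 p xs

  countB≡0⇒false : ∀ (p : A → Bool) {xs x} → countB p xs ≡ 0 → x ∈ xs → p x ≡ false
  countB≡0⇒false p {y ∷ xs} c≡0 x∈ with p y in py
  countB≡0⇒false p {y ∷ xs} c≡0 (here refl) | false = py
  countB≡0⇒false p {y ∷ xs} c≡0 (there x∈) | false = countB≡0⇒false p c≡0 x∈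

  sum-map-cong : ∀ {f g : A → ℕ} xs → (∀ {x} → x ∈ xs → f x ≡ g x) → sum (map f xs) ≡ sum (map g xs)
  sum-map-cong xs f≡g = cong sum (map-cong-local (All.tabulate f≡g))

  sum-map-∑ : ∀ {m} (f : A → Fin m → ℕ) xs → sum (map (λ x → ∑ (f x)) xs) ≡ ∑ (λ i → sum (map (λ x → f x i) xs))
  sum-map-∑ {m} f []       = sym (∑-zero {m} λ _ → refl)
  sum-map-∑     f (x ∷ xs) = trans (cong (∑ (f x) +_) (sum-map-∑ f xs)) (sym (∑-distrib-+ (f x) _))

  sum-map-zero : ∀ {f : A → ℕ} xs → (∀ {x} → x ∈ xs → f x ≡ 0) → sum (map f xs) ≡ 0
  sum-map-zero []       _   = refl
  sum-map-zero (x ∷ xs) f≡0 rewrite f≡0 (here refl) = sum-map-zero xs (f≡0 ∘ there)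

Vec-ext : ∀ {A : Set} {m} {xs ys : Vec A m} → (∀ i → lookup xs i ≡ lookup ys i) → xs ≡ ys
Vec-ext {xs = xs} {ys} eq = trans (sym (tabulate∘lookup xs)) (trans (tabulate-cong eq) (tabulate∘lookup ys))

Bool-ext : ∀ {a b} → (a ≡ true → b ≡ true) → (b ≡ true → a ≡ true) → a ≡ b
Bool-ext to from = ⇔→≡ {z = true} (mk⇔ to from)

2[1+a]+2≤2b+2 : ∀ {a b} → a < b → 2 + (2 * a + 2) ≤ 2 * b + 2
2[1+a]+2≤2b+2 {a} {b} a<b = subst (_≤ 2 * b + 2) (cong (_+ 2) (*-suc 2 a)) (+-monoˡ-≤ 2 (*-monoʳ-≤ 2 a<b))

2[1+a]≤2b : ∀ {a b} → a < b → 2 * a + 2 ≤ 2 * b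
2[1+a]≤2b {a} {b} a<b = subst (_≤ 2 * b) (trans (*-suc 2 a) (+-comm 2 (2 * a))) (*-monoʳ-≤ 2 a<b)

-- Letters and the maximal tiling

rank : Letter → ℕ
rank l0 = 0
rank l1 = 1
rank l2 = 2

>L⇒rank< : ∀ p q → p >L q ≡ true → rank q < rank p
>L⇒rank< l2 l1 _ = s≤s (s≤s z≤n)
>L⇒rank< l2 l0 _ = s≤s z≤n
>L⇒rank< l1 l0 _ = s≤s z≤n

≯L⇒rank≤ : ∀ p q → p >L q ≡ false → rank p ≤ rank q
≯L⇒rank≤ l0 q  _ = z≤n
≯L⇒rank≤ l1 l1 _ = ≤-refl
≯L⇒rank≤ l1 l2 _ = s≤s z≤n
≯L⇒rank≤ l2 l2 _ = ≤-refl

rank≤⇒≯L : ∀ p q → rank p ≤ rank q → p >L q ≡ false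
rank≤⇒≯L l0 q  _ = refl
rank≤⇒≯L l1 l1 _ = refl
rank≤⇒≯L l1 l2 _ = refl
rank≤⇒≯L l2 l2 _ = refl
rank≤⇒≯L l1 l0 ()
rank≤⇒≯L l2 l0 ()
rank≤⇒≯L l2 l1 (s≤s ())

≯L-l2 : ∀ p → p >L l2 ≢ true
≯L-l2 l0 ()
≯L-l2 l1 ()
≯L-l2 l2 ()

l0-≯L : ∀ q → l0 >L q ≢ true
l0-≯L l0 ()
l0-≯L l1 ()
l0-≯L l2 ()

l2->L⇒ : ∀ q → l2 >L q ≡ true → q ≡ l1 ⊎ q ≡ l0
l2->L⇒ l1 _ = inj₁ refl
l2->L⇒ l0 _ = inj₂ refl

>L-l0⇒ : ∀ p → p >L l0 ≡ true → p ≡ l1 ⊎ p ≡ l2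
>L-l0⇒ l1 _ = inj₁ refl
>L-l0⇒ l2 _ = inj₂ refl

module Tiling {n : ℕ} where

  Edge : Set
  Edge = Fin n × Letter

  _<ˡ_ : Edge → Edge → Set
  a <ˡ b = toℕ (proj₁ a) < toℕ (proj₁ b)

  -- a ≻ b: b comes strictly before a in the sorted word
  _≻_ : Edge → Edge → Set
  a ≻ b = rank (proj₂ b) < rank (proj₂ a) ⊎ (rank (proj₂ a) ≡ rank (proj₂ b) × b <ˡ a)

  NoDescent : Edge → Edge → Set
  NoDescent a b = proj₂ a >L proj₂ b ≡ false

  ≻⇒NoDescent : ∀ {a b} → a ≻ b → NoDescent b a
  ≻⇒NoDescent {a} {b} (inj₁ lt)      = rank≤⇒≯L (proj₂ b) (proj₂ a) (<⇒≤ lt)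
  ≻⇒NoDescent {a} {b} (inj₂ (eq , _)) = rank≤⇒≯L (proj₂ b) (proj₂ a) (≤-reflexive (sym eq))

  stepFrom-sorted : ∀ a v (y x : Edge) rest → AllPairs NoDescent (a ∷ v ++ [ y ]) → proj₂ y >L proj₂ x ≡ true →
                    stepFrom a (v ++ y ∷ x ∷ rest) ≡ just (a ∷ v ++ x ∷ y ∷ rest , (proj₁ y , proj₁ x))
  stepFrom-sorted a []      y x rest ((nd ∷ []) ∷ _) yx rewrite nd | yx = refl
  stepFrom-sorted a (b ∷ v) y x rest ((nd ∷ _) ∷ nds) yx
    rewrite nd | stepFrom-sorted b v y x rest nds yx = refl

  step-sorted : ∀ u (y x : Edge) rest → AllPairs NoDescent (u ++ [ y ]) → proj₂ y >L proj₂ x ≡ true →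
                step (u ++ y ∷ x ∷ rest) ≡ just (u ++ x ∷ y ∷ rest , (proj₁ y , proj₁ x))
  step-sorted []      y x rest _   yx rewrite yx = refl
  step-sorted (a ∷ v) y x rest nds yx = stepFrom-sorted a v y x rest nds yx

  step-nothing : ∀ (w : List Edge) → AllPairs NoDescent w → step w ≡ nothing
  step-nothing []                  _                = refl
  step-nothing (a ∷ [])            _                = refl
  step-nothing (a ∷ b ∷ w) ((nd ∷ _) ∷ nds) rewrite nd | step-nothing (b ∷ w) nds = refl

  runTiling-just : ∀ k (w : List Edge) {w′ t} → step w ≡ just (w′ , t) → runTiling (suc k) w ≡ t ∷ runTiling k w′
  runTiling-just k w eq with step w
  runTiling-just k w refl | just _ = refl

  runTiling-nothing : ∀ k (w : List Edge) → step w ≡ nothing → runTiling k w ≡ []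
  runTiling-nothing zero    w eq = refl
  runTiling-nothing (suc k) w eq with step w
  runTiling-nothing (suc k) w refl | nothing = refl

  -- x bubbles leftwards past the letters of hiR, which exceed its own letter
  runTiling-bubble : ∀ (x : Edge) loR hiR rest k → AllPairs _≻_ (hiR ++ loR) →
    All (λ y → proj₂ y >L proj₂ x ≡ true) hiR →
    runTiling (length hiR + k) (reverse loR ++ reverse hiR ++ x ∷ rest)
      ≡ map (λ y → (proj₁ y , proj₁ x)) hiR ++ runTiling k (reverse loR ++ x ∷ reverse hiR ++ rest)
  runTiling-bubble x loR []        rest k _ _ = refl
  runTiling-bubble x loR (y ∷ hiR) rest k sorted (yx ∷ hiR>x) = begin
      runTiling (suc (length hiR + k)) (reverse loR ++ reverse (y ∷ hiR) ++ x ∷ rest)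
    ≡⟨ cong (runTiling _) before ⟩
      runTiling (suc (length hiR + k)) (reverse (hiR ++ loR) ++ y ∷ x ∷ rest)
    ≡⟨ runTiling-just _ (reverse (hiR ++ loR) ++ y ∷ x ∷ rest) (step-sorted (reverse (hiR ++ loR)) y x rest noDescent yx) ⟩
      tile y ∷ runTiling (length hiR + k) (reverse (hiR ++ loR) ++ x ∷ y ∷ rest)
    ≡⟨ cong (λ w → tile y ∷ runTiling (length hiR + k) w) (reverse-++-++ hiR loR (x ∷ y ∷ rest)) ⟩
      tile y ∷ runTiling (length hiR + k) (reverse loR ++ reverse hiR ++ x ∷ y ∷ rest)
    ≡⟨ cong (tile y ∷_) (runTiling-bubble x loR hiR (y ∷ rest) k (AllPairs.tail sorted) hiR>x) ⟩
      tile y ∷ map tile hiR ++ runTiling k (reverse loR ++ x ∷ reverse hiR ++ y ∷ rest)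
    ≡⟨ cong (λ w → tile y ∷ map tile hiR ++ runTiling k (reverse loR ++ x ∷ w)) (reverse-∷-++ y hiR rest) ⟩
      tile y ∷ map tile hiR ++ runTiling k (reverse loR ++ x ∷ reverse (y ∷ hiR) ++ rest)
    ∎
    where
    open ≡-Reasoning
    tile : Edge → Fin n × Fin n
    tile y = (proj₁ y , proj₁ x)
    before : reverse loR ++ reverse (y ∷ hiR) ++ x ∷ rest ≡ reverse (hiR ++ loR) ++ y ∷ x ∷ rest
    before = begin
        reverse loR ++ reverse (y ∷ hiR) ++ x ∷ rest
      ≡⟨ cong (reverse loR ++_) (sym (reverse-∷-++ y hiR (x ∷ rest))) ⟩
        reverse loR ++ reverse hiR ++ y ∷ x ∷ rest
      ≡⟨ sym (reverse-++-++ hiR loR (y ∷ x ∷ rest)) ⟩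
        reverse (hiR ++ loR) ++ y ∷ x ∷ rest
      ∎
    noDescent : AllPairs NoDescent (reverse (hiR ++ loR) ++ [ y ])
    noDescent = subst (AllPairs NoDescent) (unfold-reverse y (hiR ++ loR))
                  (AllPairs-reverse⁺ (AllPairs.map ≻⇒NoDescent sorted))

  -- sorted words are kept reversed, so that the letters above q form a prefix
  above : Letter → List Edge → List Edge
  above q []      = []
  above q (y ∷ s) = if proj₂ y >L q then y ∷ above q s else []

  notAbove : Letter → List Edge → List Edge
  notAbove q []      = []
  notAbove q (y ∷ s) = if proj₂ y >L q then notAbove q s else y ∷ s

  above++notAbove : ∀ q s → above q s ++ notAbove q s ≡ s
  above++notAbove q []      = refl
  above++notAbove q (y ∷ s) with proj₂ y >L q
  ... | true  = cong (y ∷_) (above++notAbove q s)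
  ... | false = refl

  All-above : ∀ q s → All (λ y → proj₂ y >L q ≡ true) (above q s)
  All-above q []      = []
  All-above q (y ∷ s) with proj₂ y >L q in gt
  ... | true  = gt ∷ All-above q s
  ... | false = []

  All-notAbove : ∀ q s → AllPairs _≻_ s → All (λ y → rank (proj₂ y) ≤ rank q) (notAbove q s)
  All-notAbove q []      _        = []
  All-notAbove q (y ∷ s) (y≻ ∷ s≻) with proj₂ y >L q in ngt
  ... | true  = All-notAbove q s s≻
  ... | false = y≤q ∷ All.map (λ y≻z → ≤-trans (≻⇒rank≥ y≻z) y≤q) y≻
    where
    y≤q = ≯L⇒rank≤ _ _ ngt
    ≻⇒rank≥ : ∀ {a b} → a ≻ b → rank (proj₂ b) ≤ rank (proj₂ a)
    ≻⇒rank≥ (inj₁ lt)      = <⇒≤ lt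
    ≻⇒rank≥ (inj₂ (eq , _)) = ≤-reflexive (sym eq)

  ∈-above : ∀ q s {y} → AllPairs _≻_ s → y ∈ s → proj₂ y >L q ≡ true → y ∈ above q s
  ∈-above q s {y} s≻ y∈ gt with ∈-++⁻ (above q s) (subst (y ∈_) (sym (above++notAbove q s)) y∈)
  ... | inj₁ y∈above    = y∈above
  ... | inj₂ y∈notAbove = ⊥-elim (<⇒≱ (>L⇒rank< _ _ gt) (All.lookup (All-notAbove q s s≻) y∈notAbove))

  insert : Edge → List Edge → List Edge
  insert x s = above (proj₂ x) s ++ x ∷ notAbove (proj₂ x) s

  ∈-insert⁻ : ∀ x s {y} → y ∈ insert x s → y ≡ x ⊎ y ∈ s
  ∈-insert⁻ x s {y} y∈ with ∈-++⁻ (above (proj₂ x) s) y∈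
  ... | inj₁ y∈above       = inj₂ (subst (y ∈_) (above++notAbove (proj₂ x) s) (∈-++⁺ˡ y∈above))
  ... | inj₂ (here y≡x)    = inj₁ y≡x
  ... | inj₂ (there y∈not) = inj₂ (subst (y ∈_) (above++notAbove (proj₂ x) s) (∈-++⁺ʳ _ y∈not))

  ∈-insert⁺ : ∀ x s {y} → y ≡ x ⊎ y ∈ s → y ∈ insert x s
  ∈-insert⁺ x s (inj₁ refl) = ∈-++⁺ʳ (above (proj₂ x) s) (here refl)
  ∈-insert⁺ x s {y} (inj₂ y∈) with ∈-++⁻ (above (proj₂ x) s) (subst (y ∈_) (sym (above++notAbove (proj₂ x) s)) y∈)
  ... | inj₁ y∈above = ∈-++⁺ˡ y∈above
  ... | inj₂ y∈not   = ∈-++⁺ʳ (above (proj₂ x) s) (there y∈not)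

  All-insert : ∀ {P : Edge → Set} x s → P x → All P s → All P (insert x s)
  All-insert {P} x s px ps =
    All.tabulate λ y∈ → [ (λ { refl → px }) , All.lookup ps ]′ (∈-insert⁻ x s y∈)

  length-above : ∀ q s → length (above q s) ≤ length s
  length-above q s = subst (length (above q s) ≤_)
    (trans (sym (length-++ (above q s))) (cong length (above++notAbove q s))) (m≤m+n _ _)

  length-insert : ∀ x s → length (insert x s) ≡ suc (length s)
  length-insert x s = begin
      length (above q s ++ x ∷ notAbove q s)        ≡⟨ length-++ (above q s) ⟩
      length (above q s) + suc (length (notAbove q s)) ≡⟨ +-suc _ _ ⟩
      suc (length (above q s) + length (notAbove q s)) ≡⟨ cong suc (sym (length-++ (above q s))) ⟩
      suc (length (above q s ++ notAbove q s))        ≡⟨ cong (suc ∘ length) (above++notAbove q s) ⟩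
      suc (length s)                                  ∎
    where
    open ≡-Reasoning
    q = proj₂ x

  -- sR: the already sorted prefix (reversed); rest: the edges still to be inserted
  Invariant : List Edge → List Edge → Set
  Invariant sR rest = AllPairs _≻_ sR × AllPairs _<ˡ_ rest × All (λ y → All (y <ˡ_) rest) sR

  insert-sorted : ∀ x s → AllPairs _≻_ s → All (_<ˡ x) s → AllPairs _≻_ (insert x s)
  insert-sorted x s s≻ s<x
    with AllPairs-++⁻ (above (proj₂ x) s) (subst (AllPairs _≻_) (sym (above++notAbove (proj₂ x) s)) s≻)
  ... | above≻ , notAbove≻ , cross =
    AllPairs.++⁺ above≻ (x≻notAbove ∷ notAbove≻)
      (All.zipWith (λ (gt , y≻) → inj₁ (>L⇒rank< _ _ gt) ∷ y≻) (All-above (proj₂ x) s , cross))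
    where
    q = proj₂ x
    notAbove<x : All (_<ˡ x) (notAbove q s)
    notAbove<x = All.++⁻ʳ (above q s) (subst (All (_<ˡ x)) (sym (above++notAbove q s)) s<x)
    x≻ : ∀ {z} → rank (proj₂ z) ≤ rank q → z <ˡ x → x ≻ z
    x≻ z≤x z<x with m≤n⇒m<n∨m≡n z≤x
    ... | inj₁ lt = inj₁ lt
    ... | inj₂ eq = inj₂ (sym eq , z<x)
    x≻notAbove : All (x ≻_) (notAbove q s)
    x≻notAbove = All.zipWith (λ (z≤x , z<x) → x≻ z≤x z<x) (All-notAbove q s s≻ , notAbove<x)

  Invariant-insert : ∀ x sR rest → Invariant sR (x ∷ rest) → Invariant (insert x sR) rest
  Invariant-insert x sR rest (sR≻ , (x< ∷ rest<) , sR<) =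
    insert-sorted x sR sR≻ (All.map All.head sR<) , rest< , All-insert x sR x< (All.map All.tail sR<)

  tilesFrom : List Edge → List Edge → List (Fin n × Fin n)
  tilesFrom sR []         = []
  tilesFrom sR (x ∷ rest) = map (λ y → (proj₁ y , proj₁ x)) (above (proj₂ x) sR) ++ tilesFrom (insert x sR) rest

  length-tilesFrom : ∀ sR rest → length (tilesFrom sR rest) ≤ length rest * (length sR + length rest)
  length-tilesFrom sR []         = z≤n
  length-tilesFrom sR (x ∷ rest) = begin
      length (map tile (above q sR) ++ tilesFrom (insert x sR) rest)
    ≡⟨ trans (length-++ (map tile (above q sR))) (cong (_+ length (tilesFrom (insert x sR) rest)) (length-map tile (above q sR))) ⟩
      length (above q sR) + length (tilesFrom (insert x sR) rest)
    ≤⟨ +-mono-≤ (length-above q sR) (length-tilesFrom (insert x sR) rest) ⟩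
      length sR + length rest * (length (insert x sR) + length rest)
    ≡⟨ cong (λ m → length sR + length rest * (m + length rest)) (length-insert x sR) ⟩
      length sR + length rest * (suc (length sR) + length rest)
    ≡⟨ cong (λ m → length sR + length rest * m) (sym (+-suc (length sR) (length rest))) ⟩
      length sR + length rest * (length sR + suc (length rest))
    ≤⟨ +-monoˡ-≤ _ (m≤m+n (length sR) (suc (length rest))) ⟩
      (length sR + suc (length rest)) + length rest * (length sR + suc (length rest))
    ∎
    where
    open ≤-Reasoning
    q = proj₂ x
    tile : Edge → Fin n × Fin n
    tile y = (proj₁ y , proj₁ x)

  runTiling≡tilesFrom : ∀ sR rest k → Invariant sR rest → length (tilesFrom sR rest) ≤ k →
                        runTiling k (reverse sR ++ rest) ≡ tilesFrom sR rest
  runTiling≡tilesFrom sR [] k (sR≻ , _) _ =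
    runTiling-nothing k _ (step-nothing _
      (subst (AllPairs NoDescent) (sym (++-identityʳ _)) (AllPairs-reverse⁺ (AllPairs.map ≻⇒NoDescent sR≻))))
  runTiling≡tilesFrom sR (x ∷ rest) k inv@(sR≻ , _) fuel = begin
      runTiling k (reverse sR ++ x ∷ rest)
    ≡⟨ cong₂ runTiling (sym k≡) split ⟩
      runTiling (length H + k′) (reverse Lo ++ reverse H ++ x ∷ rest)
    ≡⟨ runTiling-bubble x Lo H rest k′ (subst (AllPairs _≻_) (sym (above++notAbove q sR)) sR≻) (All-above q sR) ⟩
      map tile H ++ runTiling k′ (reverse Lo ++ x ∷ reverse H ++ rest)
    ≡⟨ cong (λ w → map tile H ++ runTiling k′ w) merge ⟩
      map tile H ++ runTiling k′ (reverse (insert x sR) ++ rest)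
    ≡⟨ cong (map tile H ++_) (runTiling≡tilesFrom (insert x sR) rest k′ (Invariant-insert x sR rest inv) fuel′) ⟩
      map tile H ++ tilesFrom (insert x sR) rest
    ∎
    where
    open ≡-Reasoning
    q  = proj₂ x
    H  = above q sR
    Lo = notAbove q sR
    k′ = k ∸ length H
    tile : Edge → Fin n × Fin n
    tile y = (proj₁ y , proj₁ x)
    fuel₀ : length H + length (tilesFrom (insert x sR) rest) ≤ k
    fuel₀ = subst (_≤ k) (trans (length-++ (map tile H)) (cong (_+ length (tilesFrom (insert x sR) rest)) (length-map tile H))) fuel
    k≡ : length H + k′ ≡ k
    k≡ = m+[n∸m]≡n (≤-trans (m≤m+n (length H) _) fuel₀)
    fuel′ : length (tilesFrom (insert x sR) rest) ≤ k′
    fuel′ = subst (_≤ k′) (m+n∸m≡n (length H) _) (∸-monoˡ-≤ (length H) fuel₀)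
    split : reverse sR ++ x ∷ rest ≡ reverse Lo ++ reverse H ++ x ∷ rest
    split = trans (cong (λ s → reverse s ++ x ∷ rest) (sym (above++notAbove q sR))) (reverse-++-++ H Lo (x ∷ rest))
    merge : reverse Lo ++ x ∷ reverse H ++ rest ≡ reverse (insert x sR) ++ rest
    merge = trans (reverse-∷-++ x Lo (reverse H ++ rest)) (sym (reverse-++-++ H (x ∷ Lo) rest))

  ∈-tilesFrom⁻ : ∀ sR rest → Invariant sR rest → ∀ {i j} → (i , j) ∈ tilesFrom sR rest →
    ∃ λ p → ∃ λ q → (j , q) ∈ rest × ((i , p) ∈ sR ⊎ (i , p) ∈ rest × toℕ i < toℕ j) × p >L q ≡ true
  ∈-tilesFrom⁻ sR ((a , q) ∷ rest) inv@(_ , (a< ∷ _) , _) t∈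
    with ∈-++⁻ (map (λ y → (proj₁ y , a)) (above q sR)) t∈
  ... | inj₁ t∈new with ∈-map⁻ (λ y → (proj₁ y , a)) t∈new
  ...   | (b , p) , b∈ , refl =
    p , q , here refl , inj₁ (subst ((b , p) ∈_) (above++notAbove q sR) (∈-++⁺ˡ b∈)) , All.lookup (All-above q sR) b∈
  ∈-tilesFrom⁻ sR ((a , q) ∷ rest) inv@(_ , (a< ∷ _) , _) t∈ | inj₂ t∈later
    with ∈-tilesFrom⁻ (insert (a , q) sR) rest (Invariant-insert (a , q) sR rest inv) t∈later
  ... | p , q′ , j∈ , inj₂ (i∈ , i<j) , gt = p , q′ , there j∈ , inj₂ (there i∈ , i<j) , gt
  ... | p , q′ , j∈ , inj₁ i∈ , gt with ∈-insert⁻ (a , q) sR i∈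
  ...   | inj₁ refl = p , q′ , there j∈ , inj₂ (here refl , All.lookup a< j∈) , gt
  ...   | inj₂ i∈sR = p , q′ , there j∈ , inj₁ i∈sR , gt

  ∈-tilesFrom⁺ : ∀ sR rest → Invariant sR rest → ∀ {i j p q} → (j , q) ∈ rest →
    ((i , p) ∈ sR ⊎ (i , p) ∈ rest × toℕ i < toℕ j) → p >L q ≡ true → (i , j) ∈ tilesFrom sR rest
  ∈-tilesFrom⁺ sR ((a , q) ∷ rest) (sR≻ , _) (here refl) (inj₁ i∈) gt =
    ∈-++⁺ˡ (∈-map⁺ (λ y → (proj₁ y , a)) (∈-above q sR sR≻ i∈ gt))
  ∈-tilesFrom⁺ sR ((a , q) ∷ rest) _ (here refl) (inj₂ (here refl , i<i)) _ = ⊥-elim (n≮n _ i<i)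
  ∈-tilesFrom⁺ sR ((a , q) ∷ rest) (_ , (a< ∷ _) , _) (here refl) (inj₂ (there i∈ , i<a)) _ =
    ⊥-elim (<-asym i<a (All.lookup a< i∈))
  ∈-tilesFrom⁺ sR ((a , q) ∷ rest) inv (there j∈) i∈ gt =
    ∈-++⁺ʳ (map (λ y → (proj₁ y , a)) (above q sR))
      (∈-tilesFrom⁺ (insert (a , q) sR) rest (Invariant-insert (a , q) sR rest inv) j∈ i∈′ gt)
    where
    i∈′ = [ (λ i∈sR → inj₁ (∈-insert⁺ (a , q) sR (inj₂ i∈sR))) ,
            (λ { (here eq , _) → inj₁ (∈-insert⁺ (a , q) sR (inj₁ eq)) ; (there i∈ , i<j) → inj₂ (i∈ , i<j) }) ]′ i∈

  -- the order in which tiles are laid, given the rank L i of the letter at each label i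
  TileOrder : (Fin n → ℕ) → Fin n × Fin n → Fin n × Fin n → Set
  TileOrder L (i , j) (i′ , j′) =
    toℕ j < toℕ j′ ⊎ (j ≡ j′ × (L i′ < L i ⊎ (L i ≡ L i′ × toℕ i′ < toℕ i)))

  TileOrder-asym : ∀ L → Asymmetric (TileOrder L)
  TileOrder-asym L (inj₁ j<j′) (inj₁ j′<j)                      = <-asym j<j′ j′<j
  TileOrder-asym L (inj₁ j<j′) (inj₂ (refl , _))                = n≮n _ j<j′
  TileOrder-asym L (inj₂ (refl , _)) (inj₁ j′<j)                = n≮n _ j′<j
  TileOrder-asym L (inj₂ (_ , inj₁ lt)) (inj₂ (_ , inj₁ gt))    = <-asym lt gt
  TileOrder-asym L (inj₂ (_ , inj₁ lt)) (inj₂ (_ , inj₂ (eq , _))) = <-irrefl eq lt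
  TileOrder-asym L (inj₂ (_ , inj₂ (eq , _))) (inj₂ (_ , inj₁ gt)) = <-irrefl eq gt
  TileOrder-asym L (inj₂ (_ , inj₂ (_ , lt))) (inj₂ (_ , inj₂ (_ , gt))) = <-asym lt gt

  TileOrder-cong : ∀ {L L′} {i j i′ j′} → L i ≡ L′ i → L i′ ≡ L′ i′ →
                   TileOrder L (i , j) (i′ , j′) → TileOrder L′ (i , j) (i′ , j′)
  TileOrder-cong _   _    (inj₁ lt)                  = inj₁ lt
  TileOrder-cong eq  eq′  (inj₂ (j≡ , inj₁ lt))       = inj₂ (j≡ , inj₁ (subst₂ _<_ eq′ eq lt))
  TileOrder-cong eq  eq′  (inj₂ (j≡ , inj₂ (e , lt))) = inj₂ (j≡ , inj₂ (trans (sym eq) (trans e eq′) , lt))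

  tilesFrom-ordered : ∀ L sR rest → Invariant sR rest →
    All (λ y → L (proj₁ y) ≡ rank (proj₂ y)) sR → All (λ y → L (proj₁ y) ≡ rank (proj₂ y)) rest →
    AllPairs (TileOrder L) (tilesFrom sR rest)
  tilesFrom-ordered L sR []         _ _ _ = []
  tilesFrom-ordered L sR (x ∷ rest) inv@(sR≻ , (x< ∷ _) , _) LsR (Lx ∷ Lrest) =
    AllPairs.++⁺ (AllPairs.map⁺ (ordered H≻ LH))
      (tilesFrom-ordered L (insert x sR) rest (Invariant-insert x sR rest inv) (All-insert x sR Lx LsR) Lrest)
      (All.map⁺ (All.tabulate λ _ → All.tabulate λ t∈ → inj₁ (later t∈)))
    where
    H = above (proj₂ x) sR
    H≻ : AllPairs _≻_ H
    H≻ = proj₁ (AllPairs-++⁻ H (subst (AllPairs _≻_) (sym (above++notAbove (proj₂ x) sR)) sR≻))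
    LH : All (λ y → L (proj₁ y) ≡ rank (proj₂ y)) H
    LH = All.++⁻ˡ H (subst (All _) (sym (above++notAbove (proj₂ x) sR)) LsR)
    ordered : ∀ {ys} → AllPairs _≻_ ys → All (λ y → L (proj₁ y) ≡ rank (proj₂ y)) ys →
              AllPairs (λ y z → TileOrder L (proj₁ y , proj₁ x) (proj₁ z , proj₁ x)) ys
    ordered []         []         = []
    ordered (y≻ ∷ ys≻) (Ly ∷ Lys) = All.zipWith (λ (Lz , y≻z) → ≻⇒TileOrder Ly Lz y≻z) (Lys , y≻) ∷ ordered ys≻ Lys
      where
      ≻⇒TileOrder : ∀ {y z} → L (proj₁ y) ≡ rank (proj₂ y) → L (proj₁ z) ≡ rank (proj₂ z) → y ≻ z →
                    TileOrder L (proj₁ y , proj₁ x) (proj₁ z , proj₁ x)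
      ≻⇒TileOrder Ly Lz (inj₁ lt)       = inj₂ (refl , inj₁ (subst₂ _<_ (sym Lz) (sym Ly) lt))
      ≻⇒TileOrder Ly Lz (inj₂ (eq , lt)) = inj₂ (refl , inj₂ (trans Ly (trans eq (sym Lz)) , lt))
    later : ∀ {t} → t ∈ tilesFrom (insert x sR) rest → toℕ (proj₁ x) < toℕ (proj₂ t)
    later t∈ with ∈-tilesFrom⁻ (insert x sR) rest (Invariant-insert x sR rest inv) t∈
    ... | _ , _ , j∈ , _ = All.lookup x< j∈

open Tiling using (Edge; _<ˡ_; Invariant; tilesFrom; TileOrder; TileOrder-asym; TileOrder-cong)

module _ {n : ℕ} (Y : LRAT n) where

  private
    edgeAt : Fin n → Maybe Edge
    edgeAt i = Maybe.map (i ,_) (letterOf Y i)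

  ∈-border⁻ : ∀ {i p} → (i , p) ∈ border Y → letterOf Y i ≡ just p
  ∈-border⁻ = go (allFin n)
    where
    go : ∀ l {i p} → (i , p) ∈ mapMaybe edgeAt l → letterOf Y i ≡ just p
    go (k ∷ l) e∈ with letterOf Y k in eq
    go (k ∷ l) e∈          | nothing = go l e∈
    go (k ∷ l) (here refl) | just _  = eq
    go (k ∷ l) (there e∈)  | just _  = go l e∈

  ∈-border⁺ : ∀ {i p} → letterOf Y i ≡ just p → (i , p) ∈ border Y
  ∈-border⁺ {i} {p} eq = go (allFin n) (∈-allFin i)
    where
    go : ∀ l → i ∈ l → (i , p) ∈ mapMaybe edgeAt l
    go (k ∷ l) i∈ with letterOf Y k in eq′
    go (k ∷ l) (here refl) | nothing with () ← trans (sym eq) eq′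
    go (k ∷ l) (there i∈)  | nothing = go l i∈
    go (k ∷ l) (here refl) | just _  with refl ← trans (sym eq) eq′ = here refl
    go (k ∷ l) (there i∈)  | just _  = there (go l i∈)

  border-increasing : AllPairs _<ˡ_ (border Y)
  border-increasing = go (allFin n) (AllPairs.tabulate⁺-< id)
    where
    go : ∀ l → AllPairs (λ a b → toℕ a < toℕ b) l → AllPairs _<ˡ_ (mapMaybe edgeAt l)
    go []      []       = []
    go (k ∷ l) (k< ∷ l<) with letterOf Y k
    ... | nothing = go l l<
    ... | just _  = All.tabulate (λ e∈ → All.lookup k< (label∈ l e∈)) ∷ go l l<
      where
      label∈ : ∀ l {i p} → (i , p) ∈ mapMaybe edgeAt l → i ∈ l
      label∈ (k ∷ l) e∈ with letterOf Y k
      label∈ (k ∷ l) e∈          | nothing = there (label∈ l e∈)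
      label∈ (k ∷ l) (here refl) | just _  = here refl
      label∈ (k ∷ l) (there e∈)  | just _  = there (label∈ l e∈)

  letterIs-just : ∀ p {v x} → letterOf Y v ≡ just x → letterIs Y p v ≡ p x
  letterIs-just p {v} eq with letterOf Y v
  letterIs-just p refl | just _ = refl

  letterIs-nothing : ∀ p {v} → letterOf Y v ≡ nothing → letterIs Y p v ≡ false
  letterIs-nothing p eq rewrite eq = refl

  hasLabel-just : ∀ {v x} → letterOf Y v ≡ just x → hasLabel Y v ≡ true
  hasLabel-just eq rewrite eq = refl

  hasLabel-nothing : ∀ {v} → letterOf Y v ≡ nothing → hasLabel Y v ≡ false
  hasLabel-nothing eq rewrite eq = refl

  hasLabel-true : ∀ {v} → hasLabel Y v ≡ true → ∃ λ x → letterOf Y v ≡ just x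
  hasLabel-true {v} eq with letterOf Y v
  ... | just x = x , refl

  hasLabel-false : ∀ {v} → hasLabel Y v ≡ false → letterOf Y v ≡ nothing
  hasLabel-false {v} eq with letterOf Y v
  ... | nothing = refl

  size≡∑ : size Y ≡ ∑ (𝟙 ∘ hasLabel Y)
  size≡∑ = trans (go (allFin n)) (countB-allFin (hasLabel Y))
    where
    go : ∀ l → length (mapMaybe edgeAt l) ≡ countB (hasLabel Y) l
    go []      = refl
    go (k ∷ l) with letterOf Y k
    ... | nothing = go l
    ... | just _  = cong suc (go l)

  diagonals≡∑ : diagonals Y ≡ ∑ (𝟙 ∘ letterIs Y isL1)
  diagonals≡∑ = trans (go (allFin n)) (countB-allFin (letterIs Y isL1))
    where
    go : ∀ l → countB (isL1 ∘ proj₂) (mapMaybe edgeAt l) ≡ countB (letterIs Y isL1) l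
    go []      = refl
    go (k ∷ l) with letterOf Y k
    ... | nothing = go l
    ... | just x  with isL1 x
    ...   | true  = cong suc (go l)
    ...   | false = go l

  Inversion : Fin n × Fin n → Set
  Inversion (i , j) = ∃ λ p → ∃ λ q →
    letterOf Y i ≡ just p × letterOf Y j ≡ just q × p >L q ≡ true × toℕ i < toℕ j

  private
    border-invariant : Invariant [] (border Y)
    border-invariant = [] , border-increasing , []

    tiles≡tilesFrom : tiles Y ≡ tilesFrom [] (border Y)
    tiles≡tilesFrom = Tiling.runTiling≡tilesFrom [] (border Y) _ border-invariant (Tiling.length-tilesFrom [] (border Y))

  tile⇒inversion : ∀ {c} → c ∈ tiles Y → Inversion c
  tile⇒inversion c∈ with Tiling.∈-tilesFrom⁻ [] (border Y) border-invariant (subst (_ ∈_) tiles≡tilesFrom c∈)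
  ... | p , q , j∈ , inj₂ (i∈ , i<j) , gt = p , q , ∈-border⁻ i∈ , ∈-border⁻ j∈ , gt , i<j

  inversion⇒tile : ∀ {c} → Inversion c → c ∈ tiles Y
  inversion⇒tile (p , q , li , lj , gt , i<j) = subst (_ ∈_) (sym tiles≡tilesFrom)
    (Tiling.∈-tilesFrom⁺ [] (border Y) border-invariant (∈-border⁺ lj) (inj₂ (∈-border⁺ li , i<j)) gt)

  rankAt : Fin n → ℕ
  rankAt i = maybe′ rank 0 (letterOf Y i)

  tiles-ordered : AllPairs (TileOrder rankAt) (tiles Y)
  tiles-ordered = subst (AllPairs (TileOrder rankAt)) (sym tiles≡tilesFrom)
    (Tiling.tilesFrom-ordered rankAt [] (border Y) border-invariant []
      (All.tabulate λ e∈ → cong (maybe′ rank 0) (∈-border⁻ e∈)))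

  tileOrder⇒Precedes : ∀ {c c′} → c ∈ tiles Y → c′ ∈ tiles Y → TileOrder rankAt c c′ → Precedes c c′ (tiles Y)
  tileOrder⇒Precedes = related⇒precedes (TileOrder-asym rankAt) tiles-ordered

  Precedes⇒tileOrder : ∀ {c c′} → Precedes c c′ (tiles Y) → TileOrder rankAt c c′
  Precedes⇒tileOrder = precedes⇒related tiles-ordered

empty? : ∀ x → x ≡ empty ⊎ x ≢ empty
empty? empty     = inj₁ refl
empty? leftArrow = inj₂ λ ()
empty? upArrow   = inj₂ λ ()

leftArrow≢empty : ∀ {x} → x ≡ leftArrow → x ≢ empty
leftArrow≢empty refl ()

upArrow≢empty : ∀ {x} → x ≡ upArrow → x ≢ empty
upArrow≢empty refl ()

leftArrow≢upArrow : ∀ {x} → x ≡ leftArrow → x ≢ upArrow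
leftArrow≢upArrow refl ()

isLeft-true : ∀ x → isLeft x ≡ true → x ≡ leftArrow
isLeft-true leftArrow _ = refl

isUp-true : ∀ x → isUp x ≡ true → x ≡ upArrow
isUp-true upArrow _ = refl

module _ {n : ℕ} (Y : LRAT n) where

  inTile⇒ : ∀ {k i j} → inTile Y k (i , j) ≡ true → k ≡ i ⊎ k ≡ j
  inTile⇒ {k} {i} {j} eq with k Fin.≟ i | k Fin.≟ j
  ... | yes k≡i | _       = inj₁ k≡i
  ... | no _    | yes k≡j = inj₂ k≡j

  inTile-fst : ∀ {k j} → inTile Y k (k , j) ≡ true
  inTile-fst {k} with k Fin.≟ k
  ... | yes _ = refl
  ... | no k≢k = ⊥-elim (k≢k refl)

  inTile-snd : ∀ {i k} → inTile Y k (i , k) ≡ true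
  inTile-snd {i} {k} with k Fin.≟ i | k Fin.≟ k
  ... | yes _ | _     = refl
  ... | no _  | yes _ = refl
  ... | no _  | no k≢k = ⊥-elim (k≢k refl)

  firstWith-just : ∀ {R : Edge → Edge → Set} (p : Letter → Bool) w {k} → AllPairs R w → firstWith Y p w ≡ just k →
    ∃ λ x → (k , x) ∈ w × p x ≡ true × All (λ e → p (proj₂ e) ≡ true → e ≡ (k , x) ⊎ R (k , x) e) w
  firstWith-just p ((i , y) ∷ w) (r ∷ rs) eq with p y in py
  firstWith-just p ((i , y) ∷ w) (r ∷ rs) refl | true =
    y , here refl , py , (λ _ → inj₁ refl) ∷ All.map (λ r′ _ → inj₂ r′) r
  ... | false with x , x∈ , px , rest ← firstWith-just p w rs eq =
    x , there x∈ , px , (λ p≡true → ⊥-elim (false≢true (trans (sym py) p≡true))) ∷ rest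
    where
    false≢true : false ≢ true
    false≢true ()

  firstWith-nothing : ∀ (p : Letter → Bool) w → firstWith Y p w ≡ nothing → All (λ e → p (proj₂ e) ≡ false) w
  firstWith-nothing p []            _  = []
  firstWith-nothing p ((i , y) ∷ w) eq with p y in py
  ... | false = py ∷ firstWith-nothing p w eq

  topRow-least : ∀ {k} → topRow Y ≡ just k →
                 letterOf Y k ≡ just l2 × ∀ v → letterOf Y v ≡ just l2 → toℕ k ≤ toℕ v
  topRow-least {k} top with firstWith-just isL2 (border Y) (border-increasing Y) top
  ... | l2 , k∈ , _ , first = ∈-border⁻ Y k∈ , least
    where
    least : ∀ v → letterOf Y v ≡ just l2 → toℕ k ≤ toℕ v
    least v lv with All.lookup first (∈-border⁺ Y lv) refl
    ... | inj₁ refl = ≤-refl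
    ... | inj₂ k<v  = <⇒≤ k<v

  topRow-nothing : topRow Y ≡ nothing → ∀ v → letterOf Y v ≢ just l2
  topRow-nothing none v lv with () ← All.lookup (firstWith-nothing isL2 (border Y) none) (∈-border⁺ Y lv)

  leftmostCol-greatest : ∀ {k} → leftmostCol Y ≡ just k →
                         letterOf Y k ≡ just l0 × ∀ v → letterOf Y v ≡ just l0 → toℕ v ≤ toℕ k
  leftmostCol-greatest {k} left
    with firstWith-just isL0 (reverse (border Y)) (AllPairs-reverse⁺ (border-increasing Y)) left
  ... | l0 , k∈ , _ , first = ∈-border⁻ Y (Any.reverse⁻ k∈) , greatest
    where
    greatest : ∀ v → letterOf Y v ≡ just l0 → toℕ v ≤ toℕ k
    greatest v lv with All.lookup first (Any.reverse⁺ (∈-border⁺ Y lv)) refl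
    ... | inj₁ refl = ≤-refl
    ... | inj₂ v<k  = <⇒≤ v<k

  leftmostCol-nothing : leftmostCol Y ≡ nothing → ∀ v → letterOf Y v ≢ just l0
  leftmostCol-nothing none v lv
    with () ← All.lookup (firstWith-nothing isL0 (reverse (border Y)) none) (Any.reverse⁺ (∈-border⁺ Y lv))

pointer-filled : ∀ {n} {Y : LRAT n} {c c′} → Points Y c c′ → fillAt Y c ≢ empty
pointer-filled (inj₁ (fl , _)) = leftArrow≢empty fl
pointer-filled (inj₂ (fu , _)) = upArrow≢empty fu

module _ {n : ℕ} {Y Z : LRAT n} where

  letterIs-cong : ∀ p {v} → letterOf Y v ≡ letterOf Z v → letterIs Y p v ≡ letterIs Z p v
  letterIs-cong p {v} eq with letterOf Y v | letterOf Z v | eq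
  ... | just _  | just _  | refl = refl
  ... | nothing | nothing | refl = refl

isFreeRow isFreeCol : ∀ {n} → LRAT n → Fin n → Bool
isFreeRow Y v = letterIs Y isL2 v ∧ not (leftInStrip Y v)
isFreeCol Y v = letterIs Y isL0 v ∧ not (upInStrip Y v)

InStrip-closed : ∀ {n} {Y : LRAT n} (P : Fin n → Set) {k i j} → P i → P j → InStrip Y k (i , j) → P k
InStrip-closed P pi pj (inj₁ refl) = pi
InStrip-closed P pi pj (inj₂ refl) = pj

Points⇒sharedStrip : ∀ {n} {Y : LRAT n} {c c′} → Points Y c c′ → ∃ λ k → InStrip Y k c × InStrip Y k c′
Points⇒sharedStrip (inj₁ (_ , k , (_ , s , _) , (_ , s′ , _) , _)) = k , s , s′
Points⇒sharedStrip (inj₂ (_ , k , (_ , s , _) , (_ , s′ , _) , _)) = k , s , s′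

-- The forest of arrows of a RAT

module ArrowForest {n : ℕ} (Y : LRAT n) (rat : IsRATFilling Y) where

  filled⇒tile : ∀ c → fillAt Y c ≢ empty → c ∈ tiles Y
  filled⇒tile = proj₁ rat

  leftArrow⇒row : ∀ c → fillAt Y c ≡ leftArrow → ∃ λ k → InRow Y k c
  leftArrow⇒row = proj₁ (proj₂ rat)

  upArrow⇒column : ∀ c → fillAt Y c ≡ upArrow → ∃ λ k → InCol Y k c
  upArrow⇒column = proj₁ (proj₂ (proj₂ rat))

  pointed⇒empty : ∀ c c′ → Points Y c c′ → fillAt Y c′ ≡ empty
  pointed⇒empty = proj₂ (proj₂ (proj₂ rat))

  tile-letters : ∀ {i j} → (i , j) ∈ tiles Y → ∀ {a b} → letterOf Y i ≡ just a → letterOf Y j ≡ just b → a >L b ≡ true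
  tile-letters t∈ la lb with tile⇒inversion Y t∈
  ... | _ , _ , li , lj , gt , _ with refl ← trans (sym li) la | refl ← trans (sym lj) lb = gt

  leftArrow⇒ : ∀ {i j} → fillAt Y (i , j) ≡ leftArrow → letterOf Y i ≡ just l2 × (i , j) ∈ tiles Y
  leftArrow⇒ {i} {j} fl with leftArrow⇒row (i , j) fl
  ... | k , t∈ , inj₁ refl , lk = lk , t∈
  ... | k , t∈ , inj₂ refl , lk with tile⇒inversion Y t∈
  ...   | p , _ , _ , lj , gt , _ with refl ← trans (sym lj) lk = ⊥-elim (≯L-l2 p gt)

  upArrow⇒ : ∀ {i j} → fillAt Y (i , j) ≡ upArrow → letterOf Y j ≡ just l0 × (i , j) ∈ tiles Y
  upArrow⇒ {i} {j} fu with upArrow⇒column (i , j) fu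
  ... | k , t∈ , inj₂ refl , lk = lk , t∈
  ... | k , t∈ , inj₁ refl , lk with tile⇒inversion Y t∈
  ...   | _ , q , li , _ , gt , _ with refl ← trans (sym li) lk = ⊥-elim (l0-≯L q gt)

  leftArrow-points : ∀ {i j j′} → fillAt Y (i , j) ≡ leftArrow → (i , j′) ∈ tiles Y →
                     Precedes (i , j) (i , j′) (tiles Y) → fillAt Y (i , j′) ≡ empty
  leftArrow-points {i} fl t∈ prec = pointed⇒empty _ _
    (inj₁ (fl , i , (proj₂ (leftArrow⇒ fl) , inj₁ refl , proj₁ (leftArrow⇒ fl)) ,
                    (t∈ , inj₁ refl , proj₁ (leftArrow⇒ fl)) , prec))

  upArrow-points : ∀ {i i′ j} → fillAt Y (i , j) ≡ upArrow → (i′ , j) ∈ tiles Y →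
                   Precedes (i , j) (i′ , j) (tiles Y) → fillAt Y (i′ , j) ≡ empty
  upArrow-points {j = j} fu t∈ prec = pointed⇒empty _ _
    (inj₂ (fu , j , (proj₂ (upArrow⇒ fu) , inj₂ refl , proj₁ (upArrow⇒ fu)) ,
                    (t∈ , inj₂ refl , proj₁ (upArrow⇒ fu)) , prec))

  leftArrow-unique : ∀ {i j j′} → fillAt Y (i , j) ≡ leftArrow → fillAt Y (i , j′) ≡ leftArrow → j ≡ j′
  leftArrow-unique {i} {j} {j′} fl fl′ with j Fin.≟ j′
  ... | yes eq = eq
  ... | no j≢j′ with Precedes-connex (proj₂ (leftArrow⇒ fl)) (proj₂ (leftArrow⇒ fl′)) (j≢j′ ∘ cong proj₂)
  ...   | inj₁ prec = ⊥-elim (leftArrow≢empty fl′ (leftArrow-points fl (proj₂ (leftArrow⇒ fl′)) prec))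
  ...   | inj₂ prec = ⊥-elim (leftArrow≢empty fl (leftArrow-points fl′ (proj₂ (leftArrow⇒ fl)) prec))

  upArrow-unique : ∀ {i i′ j} → fillAt Y (i , j) ≡ upArrow → fillAt Y (i′ , j) ≡ upArrow → i ≡ i′
  upArrow-unique {i} {i′} fu fu′ with i Fin.≟ i′
  ... | yes eq = eq
  ... | no i≢i′ with Precedes-connex (proj₂ (upArrow⇒ fu)) (proj₂ (upArrow⇒ fu′)) (i≢i′ ∘ cong proj₁)
  ...   | inj₁ prec = ⊥-elim (upArrow≢empty fu′ (upArrow-points fu (proj₂ (upArrow⇒ fu′)) prec))
  ...   | inj₂ prec = ⊥-elim (upArrow≢empty fu (upArrow-points fu′ (proj₂ (upArrow⇒ fu)) prec))

  -- labels increase from northeast to southwest, so in a column a smaller label is further north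
  upArrow-north-of-leftArrow : ∀ {v w x} → fillAt Y (v , w) ≡ leftArrow → fillAt Y (x , w) ≡ upArrow →
                               letterOf Y x ≡ just l2 → toℕ x < toℕ v
  upArrow-north-of-leftArrow {v} {w} {x} fl fu lx with <-cmp (toℕ x) (toℕ v)
  ... | tri< x<v _ _ = x<v
  ... | tri≈ _ x≡v _ with refl ← Fin.toℕ-injective x≡v = ⊥-elim (leftArrow≢upArrow fl fu)
  ... | tri> _ _ v<x = ⊥-elim (leftArrow≢empty fl (upArrow-points fu (proj₂ (leftArrow⇒ fl))
        (tileOrder⇒Precedes Y (proj₂ (upArrow⇒ fu)) (proj₂ (leftArrow⇒ fl))
          (inj₂ (refl , inj₂ (cong (maybe′ rank 0) (trans lx (sym (proj₁ (leftArrow⇒ fl)))) , v<x))))))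

  upArrow-east-of-leftArrow : ∀ {i j k} → fillAt Y (i , j) ≡ leftArrow → fillAt Y (i , k) ≡ upArrow → toℕ k < toℕ j
  upArrow-east-of-leftArrow {i} {j} {k} fl fu with <-cmp (toℕ k) (toℕ j)
  ... | tri< k<j _ _ = k<j
  ... | tri≈ _ k≡j _ with refl ← Fin.toℕ-injective k≡j = ⊥-elim (leftArrow≢upArrow fl fu)
  ... | tri> _ _ j<k = ⊥-elim (upArrow≢empty fu (leftArrow-points fl (proj₂ (upArrow⇒ fu))
        (tileOrder⇒Precedes Y (proj₂ (leftArrow⇒ fl)) (proj₂ (upArrow⇒ fu)) (inj₁ j<k))))

  leftArrowAt upArrowAt : Fin n → Maybe (Fin n)
  leftArrowAt v = search λ j → isLeft (fillAt Y (v , j))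
  upArrowAt   v = search λ i → isUp (fillAt Y (i , v))

  -- the other label of the arrow owned by strip v: its left-arrow if v is a row, its up-arrow if v is a column
  partner : Fin n → Maybe (Fin n)
  partner v = leftArrowAt v <∣> upArrowAt v

  partner-just : ∀ v {w} → partner v ≡ just w →
    (letterOf Y v ≡ just l2 × fillAt Y (v , w) ≡ leftArrow) ⊎ (letterOf Y v ≡ just l0 × fillAt Y (w , v) ≡ upArrow)
  partner-just v eq with leftArrowAt v in found
  partner-just v refl | just j  = let fl = isLeft-true _ (search-just _ found) in inj₁ (proj₁ (leftArrow⇒ fl) , fl)
  partner-just v eq   | nothing = let fu = isUp-true _ (search-just _ eq) in inj₂ (proj₁ (upArrow⇒ fu) , fu)

  leftArrow⇒partner : ∀ {i j} → fillAt Y (i , j) ≡ leftArrow → partner i ≡ just j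
  leftArrow⇒partner {i} {j} fl with leftArrowAt i in found
  ... | just j′ = cong just (leftArrow-unique (isLeft-true _ (search-just _ found)) fl)
  ... | nothing with () ← trans (sym (cong isLeft fl)) (search-nothing _ found j)

  upArrow⇒partner : ∀ {i j} → fillAt Y (i , j) ≡ upArrow → partner j ≡ just i
  upArrow⇒partner {i} {j} fu with leftArrowAt j in found
  ... | just _ with () ← trans (sym (proj₁ (leftArrow⇒ (isLeft-true _ (search-just _ found))))) (proj₁ (upArrow⇒ fu))
  ... | nothing with upArrowAt j in found′
  ...   | just i′ = cong just (upArrow-unique (isUp-true _ (search-just _ found′)) fu)
  ...   | nothing with () ← trans (sym (cong isUp fu)) (search-nothing _ found′ i)

  arrow⇒partner : ∀ {i j} → fillAt Y (i , j) ≢ empty → partner i ≡ just j ⊎ partner j ≡ just i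
  arrow⇒partner {i} {j} ne with fillAt Y (i , j) in eq
  ... | empty     = ⊥-elim (ne refl)
  ... | leftArrow = inj₁ (leftArrow⇒partner eq)
  ... | upArrow   = inj₂ (upArrow⇒partner eq)

  Labelled : Fin n → Set
  Labelled v = ∃ λ x → letterOf Y v ≡ just x

  partner⇒labelled : ∀ v {w} → partner v ≡ just w → Labelled v × Labelled w
  partner⇒labelled v eq with partner-just v eq
  ... | inj₁ (_ , fl) with tile⇒inversion Y (proj₂ (leftArrow⇒ fl))
  ...   | p , q , lv , lw , _ = (p , lv) , (q , lw)
  partner⇒labelled v eq | inj₂ (_ , fu) with tile⇒inversion Y (proj₂ (upArrow⇒ fu))
  ...   | p , q , lw , lv , _ = (q , lv) , (p , lw)

  partner-unlabelled : ∀ {v} → letterOf Y v ≡ nothing → partner v ≡ nothing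
  partner-unlabelled {v} lv with partner v in eq
  ... | nothing = refl
  ... | just w with (x , lv′) , _ ← partner⇒labelled v eq with () ← trans (sym lv) lv′

  diagonal⇒no-partner : ∀ {v} → letterOf Y v ≡ just l1 → partner v ≡ nothing
  diagonal⇒no-partner {v} lv with partner v in eq
  ... | nothing = refl
  ... | just w with partner-just v eq
  ...   | inj₁ (lv′ , _) with () ← trans (sym lv) lv′
  ...   | inj₂ (lv′ , _) with () ← trans (sym lv) lv′

  partner-view : ∀ v → partner v ≡ nothing ⊎ ∃ λ w → partner v ≡ just w
  partner-view v with partner v
  ... | nothing = inj₁ refl
  ... | just w  = inj₂ (w , refl)

  parent : Fin n → Fin n
  parent v = maybe′ id v (partner v)

  parent-just : ∀ {v w} → partner v ≡ just w → parent v ≡ w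
  parent-just eq rewrite eq = refl

  parent-nothing : ∀ {v} → partner v ≡ nothing → parent v ≡ v
  parent-nothing eq rewrite eq = refl

  -- partner links alternate between rows and columns, and the rows met along a chain have
  -- decreasing labels (upArrow-north-of-leftArrow), so height decreases along them
  rowHeight : Fin n → ℕ
  rowHeight x = maybe′ (λ _ → 2 * toℕ x + 2) 0 (partner x)

  height : Fin n → ℕ
  height v = if letterIs Y isL0 v then maybe′ (suc ∘ rowHeight) 0 (partner v) else rowHeight v

  rowHeight≤ : ∀ x → rowHeight x ≤ 2 * toℕ x + 2
  rowHeight≤ x with partner x
  ... | just _  = ≤-refl
  ... | nothing = z≤n

  rowHeight-free : ∀ {x} → partner x ≡ nothing → rowHeight x ≡ 0
  rowHeight-free eq rewrite eq = refl

  height-nothing : ∀ {v} → partner v ≡ nothing → height v ≡ 0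
  height-nothing {v} eq rewrite eq with letterIs Y isL0 v
  ... | true  = refl
  ... | false = refl

  height-notColumn : ∀ {v p} → letterOf Y v ≡ just p → p >L l0 ≡ true → height v ≡ rowHeight v
  height-notColumn {v} lv gt rewrite letterIs-just Y isL0 lv with >L-l0⇒ _ gt
  ... | inj₁ refl = refl
  ... | inj₂ refl = refl

  height-column : ∀ {v w} → letterOf Y v ≡ just l0 → partner v ≡ just w → height v ≡ suc (rowHeight w)
  height-column lv eq rewrite letterIs-just Y isL0 lv | eq = refl

  height-row : ∀ {v w} → letterOf Y v ≡ just l2 → partner v ≡ just w → height v ≡ 2 * toℕ v + 2
  height-row lv eq rewrite letterIs-just Y isL0 lv | eq = refl

  height-partner< : ∀ {v w} → partner v ≡ just w → height w < height v
  height-partner< {v} {w} eq with partner-just v eq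
  ... | inj₂ (lv , fu) with tile⇒inversion Y (proj₂ (upArrow⇒ fu))
  ...   | _ , _ , lw , lv′ , gt , _ with refl ← trans (sym lv) lv′ =
    subst₂ _<_ (sym (height-notColumn lw gt)) (sym (height-column lv eq)) ≤-refl
  height-partner< {v} {w} eq | inj₁ (lv , fl) with tile⇒inversion Y (proj₂ (leftArrow⇒ fl))
  ... | _ , q , lv′ , lw , gt , _ with refl ← trans (sym lv) lv′ =
    subst (height w <_) (sym (height-row lv eq)) (below q lw gt (partner w) refl)
    where
    below : ∀ q → letterOf Y w ≡ just q → l2 >L q ≡ true → ∀ m → partner w ≡ m → height w < 2 * toℕ v + 2
    below q lw gt nothing  eq′ = subst (_< _) (sym (height-nothing eq′)) (<-≤-trans (s≤s z≤n) (m≤n+m 2 _))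
    below q lw gt (just x) eq′ with l2->L⇒ q gt
    ... | inj₁ refl with () ← trans (sym (diagonal⇒no-partner lw)) eq′
    ... | inj₂ refl with partner-just w eq′
    ...   | inj₁ (lw′ , _) with () ← trans (sym lw) lw′
    ...   | inj₂ (_ , fu) with tile⇒inversion Y (proj₂ (upArrow⇒ fu))
    ...     | p′ , _ , lx , lw′ , gt′ , _ with refl ← trans (sym lw) lw′ | >L-l0⇒ p′ gt′
    ...       | inj₁ refl = subst (_< _) (sym (trans (height-column lw eq′) (cong suc (rowHeight-free (diagonal⇒no-partner lx)))))
                              (m≤n+m 2 _)
    ...       | inj₂ refl = subst (_< _) (sym (height-column lw eq′))
                              (≤-trans (s≤s (s≤s (rowHeight≤ x))) (2[1+a]+2≤2b+2 (upArrow-north-of-leftArrow fl fu lx)))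

  maxHeight : ℕ
  maxHeight = suc (2 * n)

  height≤ : ∀ v → height v ≤ maxHeight
  height≤ v with letterIs Y isL0 v
  ... | false = ≤-trans (rowHeight≤ v) (≤-trans (2[1+a]≤2b (Fin.toℕ<n v)) (n≤1+n _))
  ... | true with partner v
  ...   | nothing = z≤n
  ...   | just w  = s≤s (≤-trans (rowHeight≤ w) (2[1+a]≤2b (Fin.toℕ<n w)))

  ancestor : ℕ → Fin n → Fin n
  ancestor zero    v = v
  ancestor (suc k) v = ancestor k (parent v)

  ancestor-suc : ∀ k v → ancestor (suc k) v ≡ parent (ancestor k v)
  ancestor-suc zero    v = refl
  ancestor-suc (suc k) v = ancestor-suc k (parent v)

  ancestor-fixed : ∀ {v} → partner v ≡ nothing → ∀ k → ancestor k v ≡ v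
  ancestor-fixed eq zero    = refl
  ancestor-fixed eq (suc k) rewrite parent-nothing eq = ancestor-fixed eq k

  ancestor-no-partner : ∀ k v → height v ≤ k → partner (ancestor k v) ≡ nothing
  ancestor-no-partner k v h with partner-view v
  ... | inj₁ eq = subst (λ u → partner u ≡ nothing) (sym (ancestor-fixed eq k)) eq
  ancestor-no-partner zero    v h | inj₂ (w , eq) = ⊥-elim (n≮0 (≤-trans (height-partner< eq) h))
  ancestor-no-partner (suc k) v h | inj₂ (w , eq) rewrite parent-just eq =
    ancestor-no-partner k w (≤-pred (≤-trans (height-partner< eq) h))

  root : Fin n → Fin n
  root = ancestor maxHeight

  root-no-partner : ∀ v → partner (root v) ≡ nothing
  root-no-partner v = ancestor-no-partner maxHeight v (height≤ v)

  root-self : ∀ {v} → partner v ≡ nothing → root v ≡ v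
  root-self eq = ancestor-fixed eq maxHeight

  root-parent : ∀ v → root (parent v) ≡ root v
  root-parent v = trans (ancestor-suc maxHeight v) (parent-nothing (root-no-partner v))

  root-partner : ∀ {v w} → partner v ≡ just w → root v ≡ root w
  root-partner {v} eq = trans (sym (root-parent v)) (cong root (parent-just eq))

  root-arrow : ∀ {i j} → fillAt Y (i , j) ≢ empty → root i ≡ root j
  root-arrow ne with arrow⇒partner ne
  ... | inj₁ eq = root-partner eq
  ... | inj₂ eq = sym (root-partner eq)

  ≃⇒root≡ : ∀ {i j} → _≃_ Y i j → root i ≡ root j
  ≃⇒root≡ ε            = refl
  ≃⇒root≡ (fwd a ◅ i≃j) = trans (root-arrow a) (≃⇒root≡ i≃j)
  ≃⇒root≡ (bwd a ◅ i≃j) = trans (sym (root-arrow a)) (≃⇒root≡ i≃j)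

  parent-≃ : ∀ v → _≃_ Y v (parent v)
  parent-≃ v with partner v in eq
  ... | nothing = ε
  ... | just w with partner-just v eq
  ...   | inj₁ (_ , fl) = fwd (leftArrow≢empty fl) ◅ ε
  ...   | inj₂ (_ , fu) = bwd (upArrow≢empty fu) ◅ ε

  ancestor-≃ : ∀ k v → _≃_ Y v (ancestor k v)
  ancestor-≃ zero    v = ε
  ancestor-≃ (suc k) v = parent-≃ v ◅◅ ancestor-≃ k (parent v)

  root≡⇒≃ : ∀ {i j} → root i ≡ root j → _≃_ Y i j
  root≡⇒≃ {i} {j} eq =
    ancestor-≃ maxHeight i ◅◅ subst (λ r → _≃_ Y r j) (sym eq) (EqClosure.symmetric _ (ancestor-≃ maxHeight j))

  parent-labelled : ∀ {v} → Labelled v → Labelled (parent v)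
  parent-labelled {v} lv with partner v in eq
  ... | nothing = lv
  ... | just w  = proj₂ (partner⇒labelled v eq)

  root-labelled : ∀ {v} → Labelled v → Labelled (root v)
  root-labelled = go maxHeight
    where
    go : ∀ k {v} → Labelled v → Labelled (ancestor k v)
    go zero    lv = lv
    go (suc k) lv = go k (parent-labelled lv)

  isRoot : Fin n → Bool
  isRoot v = not (is-just (partner v))

  isRoot⇒no-partner : ∀ {v} → isRoot v ≡ true → partner v ≡ nothing
  isRoot⇒no-partner {v} r with partner v
  ... | nothing = refl

  leftInStrip≡ : ∀ {k} → letterOf Y k ≡ just l2 → leftInStrip Y k ≡ is-just (partner k)
  leftInStrip≡ {k} lk with partner k in eq
  ... | just w with partner-just k eq
  ...   | inj₁ (_ , fl) = any≡true⁺ _ (proj₂ (leftArrow⇒ fl)) (cong₂ _∧_ (inTile-fst Y {k} {w}) (cong isLeft fl))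
  ...   | inj₂ (lk′ , _) with () ← trans (sym lk) lk′
  leftInStrip≡ {k} lk | nothing with leftInStrip Y k in found
  ... | false = refl
  ... | true with (i , j) , t∈ , hit ← any≡true⁻ _ (tiles Y) found with ∧≡true⁻ hit
  ...   | k∈c , isL with isLeft-true _ isL | inTile⇒ Y {k} {i} {j} k∈c
  ...     | fl | inj₁ refl with () ← trans (sym (leftArrow⇒partner fl)) eq
  ...     | fl | inj₂ refl = ⊥-elim (≯L-l2 l2 (tile-letters t∈ (proj₁ (leftArrow⇒ fl)) lk))

  upInStrip≡ : ∀ {k} → letterOf Y k ≡ just l0 → upInStrip Y k ≡ is-just (partner k)
  upInStrip≡ {k} lk with partner k in eq
  ... | just w with partner-just k eq
  ...   | inj₂ (_ , fu) = any≡true⁺ _ (proj₂ (upArrow⇒ fu)) (cong₂ _∧_ (inTile-snd Y {w} {k}) (cong isUp fu))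
  ...   | inj₁ (lk′ , _) with () ← trans (sym lk) lk′
  upInStrip≡ {k} lk | nothing with upInStrip Y k in found
  ... | false = refl
  ... | true with (i , j) , t∈ , hit ← any≡true⁻ _ (tiles Y) found with ∧≡true⁻ hit
  ...   | k∈c , isU with isUp-true _ isU | inTile⇒ Y {k} {i} {j} k∈c
  ...     | fu | inj₂ refl with () ← trans (sym (upArrow⇒partner fu)) eq
  ...     | fu | inj₁ refl = ⊥-elim (l0-≯L l0 (tile-letters t∈ lk (proj₁ (upArrow⇒ fu))))

  freeRow≡ : ∀ v → letterIs Y isL2 v ∧ not (leftInStrip Y v) ≡ letterIs Y isL2 v ∧ isRoot v
  freeRow≡ v with letterOf Y v in lv
  ... | nothing = refl
  ... | just l0 = refl
  ... | just l1 = refl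
  ... | just l2 rewrite leftInStrip≡ lv = refl

  freeColumn≡ : ∀ v → letterIs Y isL0 v ∧ not (upInStrip Y v) ≡ letterIs Y isL0 v ∧ isRoot v
  freeColumn≡ v with letterOf Y v in lv
  ... | nothing = refl
  ... | just l0 rewrite upInStrip≡ lv = refl
  ... | just l1 = refl
  ... | just l2 = refl

  freeRows≡∑ : freeRows Y ≡ ∑ (λ v → 𝟙 (letterIs Y isL2 v ∧ isRoot v))
  freeRows≡∑ = trans (countB-allFin λ v → letterIs Y isL2 v ∧ not (leftInStrip Y v)) (sum-cong-≗ (cong 𝟙 ∘ freeRow≡))

  freeCols≡∑ : freeCols Y ≡ ∑ (λ v → 𝟙 (letterIs Y isL0 v ∧ isRoot v))
  freeCols≡∑ = trans (countB-allFin λ v → letterIs Y isL0 v ∧ not (upInStrip Y v)) (sum-cong-≗ (cong 𝟙 ∘ freeColumn≡))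

  arrows≡∑ : arrows Y ≡ ∑ (λ v → 𝟙 (is-just (partner v)))
  arrows≡∑ = begin
      arrows Y
    ≡⟨ sum-map-tabulate {m = n} (λ i → countB (λ j → isArrow (fillAt Y (i , j))) (allFin n)) id ⟩
      ∑ (λ i → countB (λ j → isArrow (fillAt Y (i , j))) (allFin n))
    ≡⟨ sum-cong-≗ (λ i → trans (countB-allFin (λ j → isArrow (fillAt Y (i , j))))
                         (trans (sum-cong-≗ (λ j → arrow-split (fillAt Y (i , j)))) (∑-distrib-+ (L i) (U i)))) ⟩
      ∑ (λ i → ∑ (L i) + ∑ (U i))
    ≡⟨ ∑-distrib-+ (λ i → ∑ (L i)) (λ i → ∑ (U i)) ⟩
      ∑ (λ i → ∑ (L i)) + ∑ (λ i → ∑ (U i))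
    ≡⟨ cong (∑ (λ i → ∑ (L i)) +_) (∑-comm U) ⟩
      ∑ (λ i → ∑ (L i)) + ∑ (λ j → ∑ (λ i → U i j))
    ≡⟨ cong₂ _+_ (sum-cong-≗ λ i → ∑-𝟙-search (λ j → isLeft (fillAt Y (i , j)))
                                     λ j j′ l l′ → leftArrow-unique (isLeft-true _ l) (isLeft-true _ l′))
                 (sum-cong-≗ λ j → ∑-𝟙-search (λ i → isUp (fillAt Y (i , j)))
                                     λ i i′ u u′ → upArrow-unique (isUp-true _ u) (isUp-true _ u′)) ⟩
      ∑ (λ v → 𝟙 (is-just (leftArrowAt v))) + ∑ (λ v → 𝟙 (is-just (upArrowAt v)))
    ≡⟨ sym (∑-distrib-+ (λ v → 𝟙 (is-just (leftArrowAt v))) (λ v → 𝟙 (is-just (upArrowAt v)))) ⟩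
      ∑ (λ v → 𝟙 (is-just (leftArrowAt v)) + 𝟙 (is-just (upArrowAt v)))
    ≡⟨ sum-cong-≗ owned ⟩
      ∑ (λ v → 𝟙 (is-just (partner v)))
    ∎
    where
    open ≡-Reasoning
    L U : Fin n → Fin n → ℕ
    L i j = 𝟙 (isLeft (fillAt Y (i , j)))
    U i j = 𝟙 (isUp (fillAt Y (i , j)))
    arrow-split : ∀ c → 𝟙 (isArrow c) ≡ 𝟙 (isLeft c) + 𝟙 (isUp c)
    arrow-split empty     = refl
    arrow-split leftArrow = refl
    arrow-split upArrow   = refl
    owned : ∀ v → 𝟙 (is-just (leftArrowAt v)) + 𝟙 (is-just (upArrowAt v)) ≡ 𝟙 (is-just (partner v))
    owned v with leftArrowAt v in foundL
    ... | nothing = refl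
    ... | just _ with upArrowAt v in foundU
    ...   | nothing = refl
    ...   | just _ with () ← trans (sym (proj₁ (leftArrow⇒ (isLeft-true _ (search-just _ foundL)))))
                                   (proj₁ (upArrow⇒ (isUp-true _ (search-just _ foundU))))

  labelledRoot : Fin n → Bool
  labelledRoot v = hasLabel Y v ∧ isRoot v

  size≡arrows+roots : size Y ≡ arrows Y + ∑ (𝟙 ∘ labelledRoot)
  size≡arrows+roots = begin
      size Y                                                     ≡⟨ size≡∑ Y ⟩
      ∑ (𝟙 ∘ hasLabel Y)                                         ≡⟨ sum-cong-≗ split ⟩
      ∑ (λ v → 𝟙 (is-just (partner v)) + 𝟙 (labelledRoot v))    ≡⟨ ∑-distrib-+ owns (𝟙 ∘ labelledRoot) ⟩
      ∑ owns + ∑ (𝟙 ∘ labelledRoot)                              ≡⟨ cong (_+ ∑ (𝟙 ∘ labelledRoot)) (sym arrows≡∑) ⟩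
      arrows Y + ∑ (𝟙 ∘ labelledRoot)                            ∎
    where
    open ≡-Reasoning
    owns : Fin n → ℕ
    owns v = 𝟙 (is-just (partner v))
    split : ∀ v → 𝟙 (hasLabel Y v) ≡ 𝟙 (is-just (partner v)) + 𝟙 (labelledRoot v)
    split v with letterOf Y v in lv
    ... | nothing rewrite partner-unlabelled lv = refl
    ... | just _  with partner v
    ...   | nothing = refl
    ...   | just _  = refl

  roots≡free : ∑ (𝟙 ∘ labelledRoot) ≡ freeRows Y + freeCols Y + diagonals Y
  roots≡free = begin
      ∑ (𝟙 ∘ labelledRoot)
    ≡⟨ sum-cong-≗ split ⟩
      ∑ (λ v → R v + C v + D v)
    ≡⟨ trans (∑-distrib-+ (λ v → R v + C v) D) (cong (_+ ∑ D) (∑-distrib-+ R C)) ⟩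
      ∑ R + ∑ C + ∑ D
    ≡⟨ sym (cong₂ _+_ (cong₂ _+_ freeRows≡∑ freeCols≡∑) (diagonals≡∑ Y)) ⟩
      freeRows Y + freeCols Y + diagonals Y
    ∎
    where
    open ≡-Reasoning
    R C D : Fin n → ℕ
    R v = 𝟙 (letterIs Y isL2 v ∧ isRoot v)
    C v = 𝟙 (letterIs Y isL0 v ∧ isRoot v)
    D v = 𝟙 (letterIs Y isL1 v)
    split : ∀ v → 𝟙 (labelledRoot v) ≡ R v + C v + D v
    split v with letterOf Y v in lv
    ... | nothing = refl
    ... | just l0 = sym (+-identityʳ _)
    ... | just l1 rewrite diagonal⇒no-partner lv = refl
    ... | just l2 = sym (trans (+-identityʳ _) (+-identityʳ _))

  packed⇒one-root : Packed Y → ∑ (𝟙 ∘ labelledRoot) ≡ 1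
  packed⇒one-root packed = sym (+-cancelˡ-≡ (arrows Y) _ _ (trans packed size≡arrows+roots))

  packed⇒free≡1 : Packed Y → freeRows Y + freeCols Y + diagonals Y ≡ 1
  packed⇒free≡1 packed = trans (sym roots≡free) (packed⇒one-root packed)

  packed⇒connected : Packed Y → ∀ {u v} → Labelled u → Labelled v → _≃_ Y u v
  packed⇒connected packed lu lv =
    root≡⇒≃ (∑-𝟙≡1⇒unique labelledRoot (packed⇒one-root packed) (root-labelledRoot lu) (root-labelledRoot lv))
    where
    root-labelledRoot : ∀ {v} → Labelled v → labelledRoot (root v) ≡ true
    root-labelledRoot {v} lv with x , lr ← root-labelled lv rewrite hasLabel-just Y lr | root-no-partner v = refl

-- Types of packed RAT

module PackedType {n : ℕ} (X : LRAT n) (rat : IsRATFilling X) (packed : Packed X) where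

  open ArrowForest X rat

  packedB≡true : packedB X ≡ true
  packedB≡true = Equivalence.to T-≡ (≡⇒≡ᵇ _ _ packed)

  free≡1 : freeRows X + freeCols X + diagonals X ≡ 1
  free≡1 = packed⇒free≡1 packed

  freeRows-positive : ∀ {v} → letterOf X v ≡ just l2 → partner v ≡ nothing → freeRows X ≢ 0
  freeRows-positive {v} lv eq fr≡0 = n≮0 (subst (1 ≤_) (trans (sym freeRows≡∑) fr≡0)
    (∑-𝟙-positive (λ v → letterIs X isL2 v ∧ isRoot v) (cong₂ _∧_ (letterIs-just X isL2 lv) (cong (not ∘ is-just) eq))))

  freeCols-positive : ∀ {v} → letterOf X v ≡ just l0 → partner v ≡ nothing → freeCols X ≢ 0
  freeCols-positive {v} lv eq fc≡0 = n≮0 (subst (1 ≤_) (trans (sym freeCols≡∑) fc≡0)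
    (∑-𝟙-positive (λ v → letterIs X isL0 v ∧ isRoot v) (cong₂ _∧_ (letterIs-just X isL0 lv) (cong (not ∘ is-just) eq))))

  diagonals-positive : ∀ {v} → letterOf X v ≡ just l1 → diagonals X ≢ 0
  diagonals-positive lv d≡0 = n≮0 (subst (1 ≤_) (trans (sym (diagonals≡∑ X)) d≡0)
    (∑-𝟙-positive (letterIs X isL1) (letterIs-just X isL1 lv)))

  -- following partners from the top row would lead to a row further north
  topRow-free : ∀ {k} → topRow X ≡ just k → freeCols X ≡ 0 → diagonals X ≡ 0 → partner k ≡ nothing
  topRow-free {k} top fc≡0 d≡0 with lk , least ← topRow-least X top | partner-view k
  ... | inj₁ eq = eq
  ... | inj₂ (j , eq) with partner-just k eq
  ...   | inj₂ (lk′ , _) with () ← trans (sym lk) lk′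
  ...   | inj₁ (_ , fl) with tile⇒inversion X (proj₂ (leftArrow⇒ fl))
  ...     | _ , q , lk′ , lj , gt , _ with refl ← trans (sym lk) lk′ | l2->L⇒ q gt
  ...       | inj₁ refl = ⊥-elim (diagonals-positive lj d≡0)
  ...       | inj₂ refl with partner-view j
  ...         | inj₁ eq′ = ⊥-elim (freeCols-positive lj eq′ fc≡0)
  ...         | inj₂ (x , eq′) with partner-just j eq′
  ...           | inj₁ (lj′ , _) with () ← trans (sym lj) lj′
  ...           | inj₂ (_ , fu) with tile⇒inversion X (proj₂ (upArrow⇒ fu))
  ...             | p , _ , lx , lj′ , gt′ , _ with refl ← trans (sym lj) lj′ | >L-l0⇒ p gt′
  ...               | inj₁ refl = ⊥-elim (diagonals-positive lx d≡0)
  ...               | inj₂ refl = ⊥-elim (<⇒≱ (upArrow-north-of-leftArrow fl fu lx) (least x lx))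

  -- following partners from the leftmost column would lead to a column further west
  leftmostCol-free : ∀ {k} → leftmostCol X ≡ just k → freeRows X ≡ 0 → diagonals X ≡ 0 → partner k ≡ nothing
  leftmostCol-free {k} left fr≡0 d≡0 with lk , greatest ← leftmostCol-greatest X left | partner-view k
  ... | inj₁ eq = eq
  ... | inj₂ (i , eq) with partner-just k eq
  ...   | inj₁ (lk′ , _) with () ← trans (sym lk) lk′
  ...   | inj₂ (_ , fu) with tile⇒inversion X (proj₂ (upArrow⇒ fu))
  ...     | p , _ , li , lk′ , gt , _ with refl ← trans (sym lk) lk′ | >L-l0⇒ p gt
  ...       | inj₁ refl = ⊥-elim (diagonals-positive li d≡0)
  ...       | inj₂ refl with partner-view i
  ...         | inj₁ eq′ = ⊥-elim (freeRows-positive li eq′ fr≡0)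
  ...         | inj₂ (j , eq′) with partner-just i eq′
  ...           | inj₂ (li′ , _) with () ← trans (sym li) li′
  ...           | inj₁ (_ , fl) with tile⇒inversion X (proj₂ (leftArrow⇒ fl))
  ...             | _ , q , li′ , lj , gt′ , _ with refl ← trans (sym li) li′ | l2->L⇒ q gt′
  ...               | inj₁ refl = ⊥-elim (diagonals-positive lj d≡0)
  ...               | inj₂ refl = ⊥-elim (<⇒≱ (upArrow-east-of-leftArrow fl fu) (greatest j lj))

  horizontal≡freeRows : 𝟙 (horizontalB X) ≡ freeRows X
  horizontal≡freeRows with topRow X in top
  ... | nothing = sym (trans freeRows≡∑ (∑-zero noFreeRow))
    where
    noFreeRow : ∀ v → 𝟙 (letterIs X isL2 v ∧ isRoot v) ≡ 0
    noFreeRow v with letterOf X v in lv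
    ... | nothing = refl
    ... | just l0 = refl
    ... | just l1 = refl
    ... | just l2 = ⊥-elim (topRow-nothing X top v lv)
  ... | just k with lk , _ ← topRow-least X top rewrite packedB≡true | leftInStrip≡ lk
    with one-of-three _ _ _ free≡1 | partner k in eq
  ...   | inj₁ fr≡0              | nothing = ⊥-elim (freeRows-positive lk eq fr≡0)
  ...   | inj₁ fr≡0              | just _  = trans (cong 𝟙 (∧-zeroʳ _)) (sym fr≡0)
  ...   | inj₂ (fr≡1 , _ , d≡0)  | nothing rewrite d≡0 = sym fr≡1
  ...   | inj₂ (_ , fc≡0 , d≡0)  | just _  with () ← trans (sym eq) (topRow-free top fc≡0 d≡0)

  vertical≡freeCols : 𝟙 (verticalB X) ≡ freeCols X
  vertical≡freeCols with leftmostCol X in left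
  ... | nothing = sym (trans freeCols≡∑ (∑-zero noFreeCol))
    where
    noFreeCol : ∀ v → 𝟙 (letterIs X isL0 v ∧ isRoot v) ≡ 0
    noFreeCol v with letterOf X v in lv
    ... | nothing = refl
    ... | just l0 = ⊥-elim (leftmostCol-nothing X left v lv)
    ... | just l1 = refl
    ... | just l2 = refl
  ... | just k with lk , _ ← leftmostCol-greatest X left rewrite packedB≡true | upInStrip≡ lk
    with one-of-three (freeCols X) (freeRows X) (diagonals X)
           (trans (cong (_+ diagonals X) (+-comm (freeCols X) (freeRows X))) free≡1) | partner k in eq
  ...   | inj₁ fc≡0              | nothing = ⊥-elim (freeCols-positive lk eq fc≡0)
  ...   | inj₁ fc≡0              | just _  = trans (cong 𝟙 (∧-zeroʳ _)) (sym fc≡0)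
  ...   | inj₂ (fc≡1 , _ , d≡0)  | nothing rewrite d≡0 = sym fc≡1
  ...   | inj₂ (_ , fr≡0 , d≡0)  | just _  with () ← trans (sym eq) (leftmostCol-free left fr≡0 d≡0)

  diagonal≡diagonals : 𝟙 (diagonalB X) ≡ diagonals X
  diagonal≡diagonals rewrite packedB≡true = 𝟙-≡ᵇ1 (subst (diagonals X ≤_) free≡1 (m≤n+m _ _))

-- Restriction to a set of labels

module Transport {n : ℕ} (Y Z : LRAT n) (A : Fin n → Bool)
                 (agree : ∀ i → A i ≡ true → letterOf Y i ≡ letterOf Z i) where

  tile-transport : ∀ {i j} → A i ≡ true → A j ≡ true → (i , j) ∈ tiles Y → (i , j) ∈ tiles Z
  tile-transport {i} {j} ai aj t∈ with p , q , li , lj , gt , i<j ← tile⇒inversion Y t∈ =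
    inversion⇒tile Z (p , q , trans (sym (agree i ai)) li , trans (sym (agree j aj)) lj , gt , i<j)

  Precedes-transport : ∀ {i j i′ j′} → A i ≡ true → A j ≡ true → A i′ ≡ true → A j′ ≡ true →
                       Precedes (i , j) (i′ , j′) (tiles Y) → Precedes (i , j) (i′ , j′) (tiles Z)
  Precedes-transport {i} {i′ = i′} ai aj ai′ aj′ prec with t∈ , t′∈ ← Precedes⇒∈ prec =
    tileOrder⇒Precedes Z (tile-transport ai aj t∈) (tile-transport ai′ aj′ t′∈)
      (TileOrder-cong (cong (maybe′ rank 0) (agree i ai)) (cong (maybe′ rank 0) (agree i′ ai′)) (Precedes⇒tileOrder Y prec))

  InRow-transport : ∀ {k i j} → A i ≡ true → A j ≡ true → InRow Y k (i , j) → InRow Z k (i , j)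
  InRow-transport ai aj (t∈ , k∈ , lk) =
    tile-transport ai aj t∈ , k∈ , trans (sym (agree _ (InStrip-closed {Y = Y} (λ k → A k ≡ true) ai aj k∈))) lk

  InCol-transport : ∀ {k i j} → A i ≡ true → A j ≡ true → InCol Y k (i , j) → InCol Z k (i , j)
  InCol-transport ai aj (t∈ , k∈ , lk) =
    tile-transport ai aj t∈ , k∈ , trans (sym (agree _ (InStrip-closed {Y = Y} (λ k → A k ≡ true) ai aj k∈))) lk

  Points-transport : ∀ {i j i′ j′} → A i ≡ true → A j ≡ true → A i′ ≡ true → A j′ ≡ true →
                     fillAt Y (i , j) ≡ fillAt Z (i , j) → Points Y (i , j) (i′ , j′) → Points Z (i , j) (i′ , j′)
  Points-transport ai aj ai′ aj′ same (inj₁ (fl , k , r , r′ , prec)) =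
    inj₁ (trans (sym same) fl , k , InRow-transport ai aj r , InRow-transport ai′ aj′ r′ , Precedes-transport ai aj ai′ aj′ prec)
  Points-transport ai aj ai′ aj′ same (inj₂ (fu , k , c , c′ , prec)) =
    inj₂ (trans (sym same) fu , k , InCol-transport ai aj c , InCol-transport ai′ aj′ c′ , Precedes-transport ai aj ai′ aj′ prec)

tile-labelled : ∀ {n} (Y : LRAT n) {i j} → (i , j) ∈ tiles Y → hasLabel Y i ≡ true × hasLabel Y j ≡ true
tile-labelled Y t∈ with _ , _ , li , lj , _ ← tile⇒inversion Y t∈ = hasLabel-just Y li , hasLabel-just Y lj

module Restriction {n : ℕ} (T : LRAT n) (L : Subset n) where

  letterOf-restrict : ∀ i → letterOf (restrict T L) i ≡ (if lookup L i then letterOf T i else nothing)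
  letterOf-restrict = lookup∘tabulate _

  fillAt-restrict : ∀ i j → fillAt (restrict T L) (i , j) ≡ (if lookup L i ∧ lookup L j then fillAt T (i , j) else empty)
  fillAt-restrict i j = trans (cong (λ row → lookup row j) (lookup∘tabulate _ i)) (lookup∘tabulate _ j)

  letterOf-restrict-∈ : ∀ {i} → lookup L i ≡ true → letterOf (restrict T L) i ≡ letterOf T i
  letterOf-restrict-∈ {i} i∈ rewrite letterOf-restrict i | i∈ = refl

  letterOf-restrict-∉ : ∀ {i} → lookup L i ≡ false → letterOf (restrict T L) i ≡ nothing
  letterOf-restrict-∉ {i} i∉ rewrite letterOf-restrict i | i∉ = refl

  fillAt-restrict-∈ : ∀ {i j} → lookup L i ≡ true → lookup L j ≡ true → fillAt (restrict T L) (i , j) ≡ fillAt T (i , j)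
  fillAt-restrict-∈ {i} {j} i∈ j∈ rewrite fillAt-restrict i j | i∈ | j∈ = refl

  restrict-filled : ∀ {i j} → fillAt (restrict T L) (i , j) ≢ empty →
                    lookup L i ≡ true × lookup L j ≡ true × fillAt (restrict T L) (i , j) ≡ fillAt T (i , j)
  restrict-filled {i} {j} ne rewrite fillAt-restrict i j with lookup L i | lookup L j
  ... | true  | true  = refl , refl , refl
  ... | true  | false = ⊥-elim (ne refl)
  ... | false | _     = ⊥-elim (ne refl)

  open Transport (restrict T L) T (lookup L) (λ _ → letterOf-restrict-∈) public
    renaming (tile-transport to tile-restrict⁻; Points-transport to Points-restrict⁻)
    using ()
  open Transport T (restrict T L) (lookup L) (λ _ → sym ∘ letterOf-restrict-∈) public
    renaming (tile-transport to tile-restrict⁺; InRow-transport to InRow-restrict⁺; InCol-transport to InCol-restrict⁺)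
    using ()

  restrict-RAT : IsRATFilling T → IsRATFilling (restrict T L)
  restrict-RAT rat = filled , lefts , ups , pointed
    where
    open ArrowForest T rat
    filled : ∀ c → fillAt (restrict T L) c ≢ empty → c ∈ tiles (restrict T L)
    filled c ne with i∈ , j∈ , same ← restrict-filled ne = tile-restrict⁺ i∈ j∈ (filled⇒tile c (ne ∘ trans same))
    lefts : ∀ c → fillAt (restrict T L) c ≡ leftArrow → ∃ λ k → InRow (restrict T L) k c
    lefts c fl with i∈ , j∈ , same ← restrict-filled (leftArrow≢empty fl) | leftArrow⇒row c (trans (sym same) fl)
    ... | k , r = k , InRow-restrict⁺ i∈ j∈ r
    ups : ∀ c → fillAt (restrict T L) c ≡ upArrow → ∃ λ k → InCol (restrict T L) k c
    ups c fu with i∈ , j∈ , same ← restrict-filled (upArrow≢empty fu) | upArrow⇒column c (trans (sym same) fu)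
    ... | k , r = k , InCol-restrict⁺ i∈ j∈ r
    pointed : ∀ c c′ → Points (restrict T L) c c′ → fillAt (restrict T L) c′ ≡ empty
    pointed c c′ pts with empty? (fillAt (restrict T L) c′)
    ... | inj₁ e   = e
    ... | inj₂ ne′ with i∈ , j∈ , same ← restrict-filled (pointer-filled {Y = restrict T L} pts)
                      | i′∈ , j′∈ , same′ ← restrict-filled ne′ =
      trans same′ (pointed⇒empty c c′ (Points-restrict⁻ i∈ j∈ i′∈ j′∈ same pts))

  hasLabel-restrict : (∀ i → letterOf T i ≢ nothing) → ∀ i → hasLabel (restrict T L) i ≡ lookup L i
  hasLabel-restrict full i with lookup L i in i∈ | letterOf T i in li
  ... | false | _       = hasLabel-nothing (restrict T L) (letterOf-restrict-∉ i∈)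
  ... | true  | just _  = hasLabel-just (restrict T L) (trans (letterOf-restrict-∈ i∈) li)
  ... | true  | nothing = ⊥-elim (full i li)

  hasLabel-restrict⇒∈ : ∀ {k} → hasLabel (restrict T L) k ≡ true → lookup L k ≡ true
  hasLabel-restrict⇒∈ {k} h with lookup L k in k∈
  ... | true  = refl
  ... | false with () ← trans (sym h) (hasLabel-nothing (restrict T L) (letterOf-restrict-∉ k∈))

  letterOf-restrict-labelled : ∀ {k} → hasLabel (restrict T L) k ≡ true → letterOf (restrict T L) k ≡ letterOf T k
  letterOf-restrict-labelled = letterOf-restrict-∈ ∘ hasLabel-restrict⇒∈

  module _ (rat : IsRATFilling T)
           (closed : ∀ {a b} → lookup L a ≡ true → SymClosure (ArrowRel T) a b → lookup L b ≡ true) where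

    private
      module F = ArrowForest T rat
      module F[L] = ArrowForest (restrict T L) (restrict-RAT rat)

    partner-restrict : ∀ {u} → lookup L u ≡ true → F[L].partner u ≡ F.partner u
    partner-restrict {u} u∈ with F.partner-view u
    ... | inj₂ (w , eq) with F.partner-just u eq
    ...   | inj₁ (_ , fl) = trans (F[L].leftArrow⇒partner (trans (fillAt-restrict-∈ u∈ w∈) fl)) (sym eq)
      where w∈ = closed u∈ (fwd (leftArrow≢empty fl))
    ...   | inj₂ (_ , fu) = trans (F[L].upArrow⇒partner (trans (fillAt-restrict-∈ w∈ u∈) fu)) (sym eq)
      where w∈ = closed u∈ (bwd (upArrow≢empty fu))
    partner-restrict {u} u∈ | inj₁ eq with F[L].partner-view u
    ... | inj₁ eq′ = trans eq′ (sym eq)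
    ... | inj₂ (w , eq′) with F[L].partner-just u eq′
    ...   | inj₁ (_ , fl) with _ , _ , same ← restrict-filled (leftArrow≢empty fl)
      with () ← trans (sym (F.leftArrow⇒partner (trans (sym same) fl))) eq
    ...   | inj₂ (_ , fu) with _ , _ , same ← restrict-filled (upArrow≢empty fu)
      with () ← trans (sym (F.upArrow⇒partner (trans (sym same) fu))) eq

    isRoot-restrict : ∀ {u} → lookup L u ≡ true → F[L].isRoot u ≡ F.isRoot u
    isRoot-restrict = cong (not ∘ is-just) ∘ partner-restrict

    isFreeRow-restrict : ∀ {v} → lookup L v ≡ true → isFreeRow (restrict T L) v ≡ isFreeRow T v
    isFreeRow-restrict {v} v∈ = trans (F[L].freeRow≡ v)
      (trans (cong₂ _∧_ (letterIs-cong {Y = restrict T L} {T} isL2 (letterOf-restrict-∈ v∈)) (isRoot-restrict v∈))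
             (sym (F.freeRow≡ v)))

    isFreeCol-restrict : ∀ {v} → lookup L v ≡ true → isFreeCol (restrict T L) v ≡ isFreeCol T v
    isFreeCol-restrict {v} v∈ = trans (F[L].freeColumn≡ v)
      (trans (cong₂ _∧_ (letterIs-cong {Y = restrict T L} {T} isL0 (letterOf-restrict-∈ v∈)) (isRoot-restrict v∈))
             (sym (F.freeColumn≡ v)))

open Restriction
-- Splitting and gluing

module _ {n : ℕ} (C : List (LRAT n)) (partition : ∀ k → countB (λ X → hasLabel X k) C ≡ 1)
         (f : LRAT n → Fin n → Bool) (g : Fin n → Bool)
         (f-outside : ∀ {X k} → X ∈ C → hasLabel X k ≡ false → f X k ≡ false)
         (f-inside  : ∀ {X k} → X ∈ C → hasLabel X k ≡ true → f X k ≡ g k) where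

  private
    per-label : ∀ k D → countB (λ X → hasLabel X k) D ≡ 1 → (∀ {X} → X ∈ D → X ∈ C) →
                sum (map (λ X → 𝟙 (f X k)) D) ≡ 𝟙 (g k)
    per-label k (X ∷ D) one D⊆C with hasLabel X k in hX
    ... | true rewrite f-inside (D⊆C (here refl)) hX =
      trans (cong (𝟙 (g k) +_) (sum-map-zero D λ X∈ → cong 𝟙 (f-outside (D⊆C (there X∈))
        (countB≡0⇒false (λ X → hasLabel X k) (suc-injective one) X∈)))) (+-identityʳ _)
    ... | false rewrite f-outside (D⊆C (here refl)) hX = per-label k D one (D⊆C ∘ there)

  countB-over-partition : (typeB : LRAT n → Bool) → (∀ {X} → X ∈ C → 𝟙 (typeB X) ≡ ∑ (𝟙 ∘ f X)) →
                          countB typeB C ≡ ∑ (𝟙 ∘ g)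
  countB-over-partition typeB type≡ = begin
      countB typeB C                       ≡⟨ countB≡sum-map-𝟙 typeB C ⟩
      sum (map (𝟙 ∘ typeB) C)              ≡⟨ sum-map-cong C type≡ ⟩
      sum (map (λ X → ∑ (𝟙 ∘ f X)) C)      ≡⟨ sum-map-∑ (λ X k → 𝟙 (f X k)) C ⟩
      ∑ (λ k → sum (map (λ X → 𝟙 (f X k)) C)) ≡⟨ sum-cong-≗ (λ k → per-label k C (partition k) id) ⟩
      ∑ (𝟙 ∘ g)                            ∎
    where open ≡-Reasoning

diagonals-over-partition : ∀ {n} (T : LRAT n) (C : List (LRAT n)) → (∀ k → countB (λ X → hasLabel X k) C ≡ 1) →
  (∀ {X} → X ∈ C → IsRATFilling X × Packed X) →
  (∀ {X k} → X ∈ C → hasLabel X k ≡ true → letterOf X k ≡ letterOf T k) →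
  countB diagonalB C ≡ diagonals T
diagonals-over-partition T C partition packed agree =
  trans (countB-over-partition C partition (λ X → letterIs X isL1) (letterIs T isL1)
          (λ {X} _ h → letterIs-nothing X isL1 (hasLabel-false X h))
          (λ {X} X∈ h → letterIs-cong {Y = X} {T} isL1 (agree X∈ h))
          diagonalB
          (λ {X} X∈ → trans (PackedType.diagonal≡diagonals X (proj₁ (packed X∈)) (proj₂ (packed X∈))) (diagonals≡∑ X)))
        (sym (diagonals≡∑ T))

IsClass-closed : ∀ {n} (T : LRAT n) {L} → IsClass T L →
                 ∀ {a b} → lookup L a ≡ true → SymClosure (ArrowRel T) a b → lookup L b ≡ true
IsClass-closed T (_ , class) {a} {b} a∈ ab =
  []=⇒lookup (proj₂ (class b) (proj₁ (class a) (lookup⇒[]= a _ a∈) ◅◅ (ab ◅ ε)))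

IsClass-witness : ∀ {n} (T : LRAT n) {L} → (cl : IsClass T L) → lookup L (proj₁ cl) ≡ true
IsClass-witness T (i , class) = []=⇒lookup (proj₂ (class i) ε)

IsClass-unique : ∀ {n} (T : LRAT n) {L L′} → IsClass T L → IsClass T L′ →
                 ∀ {c} → lookup L c ≡ true → lookup L′ c ≡ true → L ≡ L′
IsClass-unique T {L} {L′} (i , class) (i′ , class′) {c} c∈L c∈L′ = Vec-ext λ j → Bool-ext
  (λ j∈L → []=⇒lookup (proj₂ (class′ j) (i′≃i ◅◅ proj₁ (class j) (lookup⇒[]= j L j∈L))))
  (λ j∈L′ → []=⇒lookup (proj₂ (class j) (EqClosure.symmetric _ i′≃i ◅◅ proj₁ (class′ j) (lookup⇒[]= j L′ j∈L′))))
  where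
  i′≃i : _≃_ T i′ i
  i′≃i = proj₁ (class′ c) (lookup⇒[]= c L′ c∈L′) ◅◅ EqClosure.symmetric _ (proj₁ (class c) (lookup⇒[]= c L c∈L))

module Splitting {n : ℕ} (T : LRAT n) (rat : IsRATFilling T) (full : ∀ i → letterOf T i ≢ nothing) where

  open ArrowForest T rat

  class : Fin n → Subset n
  class v = Vec.tabulate λ j → ⌊ root j Fin.≟ v ⌋

  ∈-class⁻ : ∀ {v j} → lookup (class v) j ≡ true → root j ≡ v
  ∈-class⁻ {v} {j} j∈ with root j Fin.≟ v | lookup∘tabulate (λ j → ⌊ root j Fin.≟ v ⌋) j
  ... | yes eq | _ = eq
  ... | no _   | eq with () ← trans (sym eq) j∈

  ∈-class⁺ : ∀ {v j} → root j ≡ v → lookup (class v) j ≡ true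
  ∈-class⁺ {v} {j} refl with root j Fin.≟ root j | lookup∘tabulate (λ j′ → ⌊ root j′ Fin.≟ root j ⌋) j
  ... | yes _ | eq = eq
  ... | no ne | _  = ⊥-elim (ne refl)

  class-IsClass : ∀ {v} → partner v ≡ nothing → IsClass T (class v)
  class-IsClass {v} eq = v , λ j →
    (λ j∈ → root≡⇒≃ (trans (root-self eq) (sym (∈-class⁻ ([]=⇒lookup j∈))))) ,
    (λ v≃j → lookup⇒[]= j _ (∈-class⁺ (trans (sym (≃⇒root≡ v≃j)) (root-self eq))))

  IsClass⇒class : ∀ {L} → (cl : IsClass T L) → L ≡ class (root (proj₁ cl))
  IsClass⇒class cl@(i , _) = IsClass-unique T cl (class-IsClass (root-no-partner i)) (IsClass-witness T cl) (∈-class⁺ refl)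

  piece : Fin n → LRAT n
  piece v = restrict T (class v)

  roots : List (Fin n)
  roots = filterᵇ isRoot (allFin n)

  pieces : List (LRAT n)
  pieces = map piece roots

  ∈-roots⁺ : ∀ {v} → partner v ≡ nothing → v ∈ roots
  ∈-roots⁺ {v} eq = ∈-filter⁺ (T? ∘ isRoot) (∈-allFin v) (Equivalence.from T-≡ (cong (not ∘ is-just) eq))

  ∈-pieces⁻ : ∀ {X} → X ∈ pieces → ∃ λ v → partner v ≡ nothing × X ≡ piece v
  ∈-pieces⁻ X∈ with v , v∈ , refl ← ∈-map⁻ piece X∈ =
    v , isRoot⇒no-partner (Equivalence.to T-≡ (proj₂ (∈-filter⁻ (T? ∘ isRoot) {xs = allFin n} v∈))) , refl

  module _ {v : Fin n} (v-root : partner v ≡ nothing) where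

    private
      module P = ArrowForest (piece v) (restrict-RAT T (class v) rat)
      closed = IsClass-closed T (class-IsClass v-root)

    v∈class : lookup (class v) v ≡ true
    v∈class = ∈-class⁺ (root-self v-root)

    piece-one-root : ∑ (𝟙 ∘ P.labelledRoot) ≡ 1
    piece-one-root = ∑-𝟙-single P.labelledRoot only-v
      (cong₂ _∧_ (hasLabel-piece v∈class) (trans (isRoot-restrict T (class v) rat closed v∈class) (cong (not ∘ is-just) v-root)))
      where
      hasLabel-piece : ∀ {u} → lookup (class v) u ≡ true → hasLabel (piece v) u ≡ true
      hasLabel-piece u∈ = trans (hasLabel-restrict T (class v) full _) u∈
      only-v : ∀ u → P.labelledRoot u ≡ true → u ≡ v
      only-v u r with hu , ru ← ∧≡true⁻ r =
        trans (sym (root-self (isRoot⇒no-partner (trans (sym (isRoot-restrict T (class v) rat closed u∈)) ru)))) (∈-class⁻ u∈)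
        where u∈ = hasLabel-restrict⇒∈ T (class v) hu

    piece-packed : Packed (piece v)
    piece-packed = sym (trans P.size≡arrows+roots (cong (arrows (piece v) +_) piece-one-root))

  hasLabel-piece : ∀ v u → hasLabel (piece v) u ≡ lookup (class v) u
  hasLabel-piece v = hasLabel-restrict T (class v) full

  pieces-partition : ∀ k → countB (λ X → hasLabel X k) pieces ≡ 1
  pieces-partition k = begin
      countB (λ X → hasLabel X k) pieces  ≡⟨ countB-map-filterᵇ isRoot piece (λ X → hasLabel X k) (allFin n) ⟩
      countB rootOf-k (allFin n)          ≡⟨ countB-allFin rootOf-k ⟩
      ∑ (𝟙 ∘ rootOf-k)                    ≡⟨ ∑-𝟙-single rootOf-k only at ⟩
      1                                   ∎
    where
    open ≡-Reasoning
    rootOf-k : Fin n → Bool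
    rootOf-k v = isRoot v ∧ hasLabel (piece v) k
    only : ∀ v → isRoot v ∧ hasLabel (piece v) k ≡ true → v ≡ root k
    only v h = sym (∈-class⁻ (trans (sym (hasLabel-piece v k)) (proj₂ (∧≡true⁻ h))))
    at : isRoot (root k) ∧ hasLabel (piece (root k)) k ≡ true
    at = cong₂ _∧_ (cong (not ∘ is-just) (root-no-partner k)) (trans (hasLabel-piece (root k) k) (∈-class⁺ refl))

  pieces-RAT : ∀ {X} → X ∈ pieces → IsRATFilling X × Packed X
  pieces-RAT X∈ with v , v-root , refl ← ∈-pieces⁻ X∈ = restrict-RAT T (class v) rat , piece-packed v-root

  pieces-labelled : ∀ {X} → X ∈ pieces → ∃ λ k → hasLabel X k ≡ true
  pieces-labelled X∈ with v , v-root , refl ← ∈-pieces⁻ X∈ = v , trans (hasLabel-piece v v) (v∈class v-root)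

  pieces-represent : Represents pieces T
  pieces-represent X = into , from
    where
    into : X ∈ pieces → InSpl T X
    into X∈ with v , v-root , refl ← ∈-pieces⁻ X∈ = class v , class-IsClass v-root , refl
    from : InSpl T X → X ∈ pieces
    from (L , cl , refl) rewrite IsClass⇒class cl = ∈-map⁺ piece (∈-roots⁺ (root-no-partner (proj₁ cl)))

  pieces-diagonals : countB diagonalB pieces ≡ diagonals T
  pieces-diagonals = diagonals-over-partition T pieces pieces-partition pieces-RAT agree
    where
    agree : ∀ {X k} → X ∈ pieces → hasLabel X k ≡ true → letterOf X k ≡ letterOf T k
    agree X∈ h with v , _ , refl ← ∈-pieces⁻ X∈ = letterOf-restrict-labelled T (class v) h

  spl-valid : ValidColl n (diagonals T) pieces
  spl-valid = (λ _ → pieces-RAT) , pieces-partition , (λ _ → pieces-labelled) , pieces-diagonals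

module SplitInclusion {n : ℕ} (T T′ : LRAT n) (rat : IsRATFilling T) (full : ∀ i → letterOf T i ≢ nothing)
                      (spl⊆ : ∀ X → InSpl T X → InSpl T′ X) where

  open ArrowForest T rat
  open Splitting T rat full

  private
    piece-of : ∀ i → Σ (Subset n) λ L′ → piece (root i) ≡ restrict T′ L′
    piece-of i with L′ , _ , eq ← spl⊆ _ (proj₁ (pieces-represent _) (∈-map⁺ piece (∈-roots⁺ (root-no-partner i)))) = L′ , eq

    i∈class : ∀ i → lookup (class (root i)) i ≡ true
    i∈class i = ∈-class⁺ refl

  letterOf-⊆ : ∀ i → letterOf T i ≡ letterOf T′ i
  letterOf-⊆ i with L′ , eq ← piece-of i | lookup L′ i in i∈L′
  ... | true  = trans (sym (letterOf-restrict-∈ T (class (root i)) (i∈class i)))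
                      (trans (cong (λ Z → letterOf Z i) eq) (letterOf-restrict-∈ T′ L′ i∈L′))
  ... | false = ⊥-elim (full i (trans (sym (letterOf-restrict-∈ T (class (root i)) (i∈class i)))
                  (trans (cong (λ Z → letterOf Z i) eq) (letterOf-restrict-∉ T′ L′ i∈L′))))

  fillAt-⊆ : ∀ i j → fillAt T (i , j) ≢ empty → fillAt T (i , j) ≡ fillAt T′ (i , j)
  fillAt-⊆ i j ne =
    trans (sym in-piece) (trans in-T′ (proj₂ (proj₂ (restrict-filled T′ L′ (ne ∘ trans (sym in-piece) ∘ trans in-T′)))))
    where
    L′ = proj₁ (piece-of i)
    j∈class = IsClass-closed T (class-IsClass (root-no-partner i)) (i∈class i) (fwd ne)
    in-piece : fillAt (piece (root i)) (i , j) ≡ fillAt T (i , j)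
    in-piece = fillAt-restrict-∈ T (class (root i)) (i∈class i) j∈class
    in-T′ : fillAt (piece (root i)) (i , j) ≡ fillAt (restrict T′ L′) (i , j)
    in-T′ = cong (λ Z → fillAt Z (i , j)) (proj₂ (piece-of i))

LRAT-ext : ∀ {n} {Y Z : LRAT n} → (∀ i → letterOf Y i ≡ letterOf Z i) →
           (∀ i j → fillAt Y (i , j) ≡ fillAt Z (i , j)) → Y ≡ Z
LRAT-ext {Y = mkLRAT w f} {mkLRAT w′ f′} same-letters same-fill =
  cong₂ mkLRAT (Vec-ext same-letters) (Vec-ext λ i → Vec-ext λ j → same-fill i j)

spl-injective : ∀ {n} {T T′ : LRAT n} → IsRATFilling T → IsRATFilling T′ →
  (∀ i → letterOf T i ≢ nothing) → (∀ i → letterOf T′ i ≢ nothing) →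
  (∀ X → (InSpl T X → InSpl T′ X) × (InSpl T′ X → InSpl T X)) → T ≡ T′
spl-injective {T = T} {T′} rat rat′ full full′ same = LRAT-ext (SplitInclusion.letterOf-⊆ T T′ rat full (proj₁ ∘ same)) same-fill
  where
  same-fill : ∀ i j → fillAt T (i , j) ≡ fillAt T′ (i , j)
  same-fill i j with empty? (fillAt T (i , j)) | empty? (fillAt T′ (i , j))
  ... | inj₂ ne | _       = SplitInclusion.fillAt-⊆ T T′ rat full (proj₁ ∘ same) i j ne
  ... | inj₁ _  | inj₂ ne = sym (SplitInclusion.fillAt-⊆ T′ T rat′ full′ (proj₂ ∘ same) i j ne)
  ... | inj₁ e  | inj₁ e′ = trans e (sym e′)

module Gluing {n : ℕ} (C : List (LRAT n)) where

  blank : LRAT n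
  blank = mkLRAT (Vec.replicate n nothing) (Vec.replicate n (Vec.replicate n empty))

  pieceAt : List (LRAT n) → Fin n → LRAT n
  pieceAt []      i = blank
  pieceAt (X ∷ D) i = if hasLabel X i then X else pieceAt D i

  glue : LRAT n
  glue = mkLRAT (Vec.tabulate λ i → letterOf (pieceAt C i) i)
                (Vec.tabulate λ i → Vec.tabulate λ j → fillAt (pieceAt C i) (i , j))

  letterOf-glue′ : ∀ i → letterOf glue i ≡ letterOf (pieceAt C i) i
  letterOf-glue′ = lookup∘tabulate _

  fillAt-glue′ : ∀ i j → fillAt glue (i , j) ≡ fillAt (pieceAt C i) (i , j)
  fillAt-glue′ i j = trans (cong (λ row → lookup row j) (lookup∘tabulate _ i)) (lookup∘tabulate _ j)

  pieceAt-∈ : ∀ D k → countB (λ X → hasLabel X k) D ≡ 1 → pieceAt D k ∈ D × hasLabel (pieceAt D k) k ≡ true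
  pieceAt-∈ (X ∷ D) k one with hasLabel X k in hX
  ... | true  = here refl , hX
  ... | false = map₁ there (pieceAt-∈ D k one)

  pieceAt-unique : ∀ D k {X} → countB (λ X → hasLabel X k) D ≡ 1 → X ∈ D → hasLabel X k ≡ true → pieceAt D k ≡ X
  pieceAt-unique (Y ∷ D) k one X∈ hX with hasLabel Y k in hY
  pieceAt-unique (Y ∷ D) k one (here refl) hX | true  = refl
  pieceAt-unique (Y ∷ D) k one (there X∈)  hX | true
    with () ← trans (sym (countB≡0⇒false (λ X → hasLabel X k) (suc-injective one) X∈)) hX
  pieceAt-unique (Y ∷ D) k one (here refl) hX | false with () ← trans (sym hY) hX
  pieceAt-unique (Y ∷ D) k one (there X∈)  hX | false = pieceAt-unique D k one X∈ hX

  module Valid {r : ℕ} (valid : ValidColl n r C) where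

    partition : ∀ k → countB (λ X → hasLabel X k) C ≡ 1
    partition = proj₁ (proj₂ valid)

    member-RAT : ∀ {X} → X ∈ C → IsRATFilling X × Packed X
    member-RAT {X} = proj₁ valid X

    pieceAt-labelled : ∀ k → hasLabel (pieceAt C k) k ≡ true
    pieceAt-labelled k = proj₂ (pieceAt-∈ C k (partition k))

    pieceAt-member : ∀ k → pieceAt C k ∈ C
    pieceAt-member k = proj₁ (pieceAt-∈ C k (partition k))

    letterOf-glue : ∀ {X i} → X ∈ C → hasLabel X i ≡ true → letterOf glue i ≡ letterOf X i
    letterOf-glue {X} {i} X∈ h = trans (letterOf-glue′ i) (cong (λ Z → letterOf Z i) (pieceAt-unique C i (partition i) X∈ h))

    fillAt-glue : ∀ {X i j} → X ∈ C → hasLabel X i ≡ true → fillAt glue (i , j) ≡ fillAt X (i , j)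
    fillAt-glue {X} {i} {j} X∈ h = trans (fillAt-glue′ i j) (cong (λ Z → fillAt Z (i , j)) (pieceAt-unique C i (partition i) X∈ h))

    filled-labelled : ∀ {X i j} → X ∈ C → fillAt X (i , j) ≢ empty → hasLabel X i ≡ true × hasLabel X j ≡ true
    filled-labelled {X} X∈ ne = tile-labelled X (ArrowForest.filled⇒tile X (proj₁ (member-RAT X∈)) _ ne)

    module FromMember {X} (X∈ : X ∈ C) = Transport X glue (hasLabel X) (λ _ h → sym (letterOf-glue X∈ h))
    module ToMember {X} (X∈ : X ∈ C) = Transport glue X (hasLabel X) (λ _ h → letterOf-glue X∈ h)

    glue-filled-labels : ∀ {i j} → fillAt glue (i , j) ≢ empty →
                         hasLabel (pieceAt C i) i ≡ true × hasLabel (pieceAt C i) j ≡ true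
    glue-filled-labels {i} {j} ne = filled-labelled (pieceAt-member i) (ne ∘ trans (fillAt-glue′ i j))

    glue-filled-strip : ∀ {i j k} → fillAt glue (i , j) ≢ empty → InStrip glue k (i , j) →
                        hasLabel (pieceAt C k) i ≡ true × hasLabel (pieceAt C k) j ≡ true
    glue-filled-strip {i} {j} {k} ne s with hi , hj ← glue-filled-labels ne
      rewrite pieceAt-unique C k (partition k) (pieceAt-member i) (InStrip-closed {Y = glue} _ hi hj s) = hi , hj

    glue-RAT : IsRATFilling glue
    glue-RAT = filled , lefts , ups , pointed
      where
      rat : ∀ i → IsRATFilling (pieceAt C i)
      rat i = proj₁ (member-RAT (pieceAt-member i))
      filled : ∀ c → fillAt glue c ≢ empty → c ∈ tiles glue
      filled (i , j) ne with hi , hj ← glue-filled-labels ne =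
        FromMember.tile-transport (pieceAt-member i) hi hj
          (ArrowForest.filled⇒tile (pieceAt C i) (rat i) (i , j) (ne ∘ trans (fillAt-glue′ i j)))
      lefts : ∀ c → fillAt glue c ≡ leftArrow → ∃ λ k → InRow glue k c
      lefts (i , j) fl with hi , hj ← glue-filled-labels (leftArrow≢empty fl)
        with k , r ← ArrowForest.leftArrow⇒row (pieceAt C i) (rat i) (i , j) (trans (sym (fillAt-glue′ i j)) fl) =
        k , FromMember.InRow-transport (pieceAt-member i) hi hj r
      ups : ∀ c → fillAt glue c ≡ upArrow → ∃ λ k → InCol glue k c
      ups (i , j) fu with hi , hj ← glue-filled-labels (upArrow≢empty fu)
        with k , r ← ArrowForest.upArrow⇒column (pieceAt C i) (rat i) (i , j) (trans (sym (fillAt-glue′ i j)) fu) =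
        k , FromMember.InCol-transport (pieceAt-member i) hi hj r
      -- pointer and pointed cell share a strip, hence lie in the member carrying it
      pointed : ∀ c c′ → Points glue c c′ → fillAt glue c′ ≡ empty
      pointed (i , j) (i′ , j′) pts with empty? (fillAt glue (i′ , j′))
      ... | inj₁ e   = e
      ... | inj₂ ne′ with k , s , s′ ← Points⇒sharedStrip {Y = glue} pts
        with hi , hj ← glue-filled-strip (pointer-filled {Y = glue} pts) s | hi′ , hj′ ← glue-filled-strip ne′ s′ =
        trans (fillAt-glue (pieceAt-member k) hi′) (ArrowForest.pointed⇒empty (pieceAt C k) (rat k) _ _
          (ToMember.Points-transport (pieceAt-member k) hi hj hi′ hj′ (fillAt-glue (pieceAt-member k) hi) pts))

    glue-full : ∀ i → letterOf glue i ≢ nothing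
    glue-full i none with x , li ← hasLabel-true (pieceAt C i) (pieceAt-labelled i)
      with () ← trans (sym none) (trans (letterOf-glue′ i) li)

    glue-diagonals : diagonals glue ≡ r
    glue-diagonals = trans (sym (diagonals-over-partition glue C partition member-RAT (λ X∈ h → sym (letterOf-glue X∈ h))))
                           (proj₂ (proj₂ (proj₂ valid)))

    arrow-same-member : ∀ {X a b} → X ∈ C → ArrowRel glue a b → hasLabel X a ≡ hasLabel X b
    arrow-same-member {X} {a} {b} X∈ ne = Bool-ext
      (λ ha → subst (λ Z → hasLabel Z b ≡ true) (pieceAt-unique C a (partition a) X∈ ha) hb)
      (λ hb′ → subst (λ Z → hasLabel Z a ≡ true)
                 (trans (sym (pieceAt-unique C b (partition b) (pieceAt-member a) hb)) (pieceAt-unique C b (partition b) X∈ hb′)) ha)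
      where
      labelled = glue-filled-labels ne
      ha = proj₁ labelled
      hb = proj₂ labelled

    ≃⇒same-member : ∀ {X a b} → X ∈ C → _≃_ glue a b → hasLabel X a ≡ hasLabel X b
    ≃⇒same-member {X} X∈ = EqClosure.fold (On.isEquivalence (hasLabel X) isEquivalence) (arrow-same-member X∈)

    labels : LRAT n → Subset n
    labels X = Vec.tabulate (hasLabel X)

    member-IsClass : ∀ {X k} → X ∈ C → hasLabel X k ≡ true → IsClass glue (labels X)
    member-IsClass {X} {k} X∈ hk = k , λ j →
      (λ j∈ → EqClosure.map (λ {a} {b} ne → ne ∘ trans (sym (fillAt-glue X∈ (proj₁ (filled-labelled X∈ ne)))))
                (ArrowForest.packed⇒connected X (proj₁ (member-RAT X∈)) (proj₂ (member-RAT X∈))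
                  (hasLabel-true X hk) (hasLabel-true X (trans (sym (lookup∘tabulate _ j)) ([]=⇒lookup j∈))))) ,
      (λ k≃j → lookup⇒[]= j _ (trans (lookup∘tabulate _ j) (trans (sym (≃⇒same-member X∈ k≃j)) hk)))

    member≡restrict : ∀ {X} → X ∈ C → X ≡ restrict glue (labels X)
    member≡restrict {X} X∈ = LRAT-ext same-letter same-fill
      where
      lookup-labels : ∀ i → lookup (labels X) i ≡ hasLabel X i
      lookup-labels = lookup∘tabulate (hasLabel X)
      same-letter : ∀ i → letterOf X i ≡ letterOf (restrict glue (labels X)) i
      same-letter i with hasLabel X i in h
      ... | true  = trans (sym (letterOf-glue X∈ h)) (sym (letterOf-restrict-∈ glue (labels X) (trans (lookup-labels i) h)))
      ... | false = trans (hasLabel-false X h) (sym (letterOf-restrict-∉ glue (labels X) (trans (lookup-labels i) h)))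
      same-fill : ∀ i j → fillAt X (i , j) ≡ fillAt (restrict glue (labels X)) (i , j)
      same-fill i j with empty? (fillAt X (i , j)) | empty? (fillAt (restrict glue (labels X)) (i , j))
      ... | inj₁ e | inj₁ e′ = trans e (sym e′)
      ... | inj₂ ne | _ with hi , hj ← filled-labelled X∈ ne =
        trans (sym (fillAt-glue X∈ hi)) (sym (fillAt-restrict-∈ glue (labels X) (trans (lookup-labels i) hi) (trans (lookup-labels j) hj)))
      ... | inj₁ e | inj₂ ne′ with i∈ , _ , same ← restrict-filled glue (labels X) ne′ =
        ⊥-elim (ne′ (trans same (trans (fillAt-glue X∈ (trans (sym (lookup-labels i)) i∈)) e)))

    glue-represents : Represents C glue
    glue-represents X = into , from
      where
      into : X ∈ C → InSpl glue X
      into X∈ with k , hk ← proj₁ (proj₂ (proj₂ valid)) X X∈ = labels X , member-IsClass X∈ hk , member≡restrict X∈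
      from : InSpl glue X → X ∈ C
      from (L , cl@(i , _) , refl) = subst (_∈ C) (trans (member≡restrict Z∈) (cong (restrict glue) (sym L≡))) Z∈
        where
        Z∈ = pieceAt-member i
        L≡ : L ≡ labels (pieceAt C i)
        L≡ = IsClass-unique glue cl (member-IsClass Z∈ (pieceAt-labelled i)) (IsClass-witness glue cl)
               (trans (lookup∘tabulate _ i) (pieceAt-labelled i))

module _ {n r : ℕ} (T : LRAT n) (rat : IsRATFilling T) (C : List (LRAT n))
         (valid : ValidColl n r C) (represents : Represents C T) where

  private
    partition = proj₁ (proj₂ valid)
    member-RAT = proj₁ valid

    inherited : (f : LRAT n → Fin n → Bool) →
      (∀ {L} → IsClass T L → ∀ {k} → lookup L k ≡ true → f (restrict T L) k ≡ f T k) →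
      ∀ {X k} → X ∈ C → hasLabel X k ≡ true → f X k ≡ f T k
    inherited f restrict≡ X∈ h with L , cl , refl ← proj₁ (represents _) X∈ = restrict≡ cl (hasLabel-restrict⇒∈ T L h)

  horizontal-count : countB horizontalB C ≡ freeRows T
  horizontal-count = trans
    (countB-over-partition C partition isFreeRow (isFreeRow T)
      (λ {X} {k} _ h → cong (_∧ not (leftInStrip X k)) (letterIs-nothing X isL2 (hasLabel-false X h)))
      (inherited isFreeRow λ {L} cl → isFreeRow-restrict T L rat (IsClass-closed T cl))
      horizontalB
      (λ {X} X∈ → trans (PackedType.horizontal≡freeRows X (proj₁ (member-RAT X X∈)) (proj₂ (member-RAT X X∈)))
                        (countB-allFin (isFreeRow X))))
    (sym (countB-allFin (isFreeRow T)))

  vertical-count : countB verticalB C ≡ freeCols T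
  vertical-count = trans
    (countB-over-partition C partition isFreeCol (isFreeCol T)
      (λ {X} {k} _ h → cong (_∧ not (upInStrip X k)) (letterIs-nothing X isL0 (hasLabel-false X h)))
      (inherited isFreeCol λ {L} cl → isFreeCol-restrict T L rat (IsClass-closed T cl))
      verticalB
      (λ {X} X∈ → trans (PackedType.vertical≡freeCols X (proj₁ (member-RAT X X∈)) (proj₂ (member-RAT X X∈)))
                        (countB-allFin (isFreeCol X))))
    (sym (countB-allFin (isFreeCol T)))

spl-wellDefined : ∀ {n r} (T : LRAT n) → InRAT T r → Σ (List (LRAT n)) λ C → ValidColl n r C × Represents C T
spl-wellDefined T (full , refl , rat) = pieces , spl-valid , pieces-represent
  where open Splitting T rat full

spl-surjective : ∀ {n r} (C : List (LRAT n)) → ValidColl n r C → Σ (LRAT n) λ T → InRAT T r × Represents C T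
spl-surjective C valid = glue , (glue-full , glue-diagonals , glue-RAT) , glue-represents
  where
  open Gluing C
  open Valid valid

theorem3p2 : (n r : ℕ) → r ≤ n →
    -- spl is well defined into the target set
    ((T : LRAT n) → InRAT T r → Σ (List (LRAT n)) λ C → ValidColl n r C × Represents C T)
    -- spl is injective
    × ((T T′ : LRAT n) → InRAT T r → InRAT T′ r →
        (∀ X → (InSpl T X → InSpl T′ X) × (InSpl T′ X → InSpl T X)) → T ≡ T′)
    -- spl is surjective
    × ((C : List (LRAT n)) → ValidColl n r C → Σ (LRAT n) λ T → InRAT T r × Represents C T)
    -- free rows / free columns count horizontal / vertical type members
    × ((T : LRAT n) (C : List (LRAT n)) → InRAT T r → ValidColl n r C → Represents C T →
        (countB horizontalB C ≡ freeRows T) × (countB verticalB C ≡ freeCols T))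
theorem3p2 n r _ =
  spl-wellDefined ,
  (λ { T T′ (full , _ , rat) (full′ , _ , rat′) → spl-injective rat rat′ full full′ }) ,
  spl-surjective ,
  (λ { T C (_ , _ , rat) valid represents → horizontal-count T rat C valid represents , vertical-count T rat C valid represents })
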